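{- Let $u$ and $v$ be indeterminates and let \begin{align*} \widetilde{\alpha}_{k}^{u,v}(x):=\sum_{\ell=0}^{k}\genfrac{[}{]}{0pt}{}{k}{\ell}_{q}(u;q)_{\ell}\,v^{\ell}x^{k-\ell}=\sum_{\ell=0}^{k}\genfrac{[}{]}{0pt}{}{k}{\ell}_{q}(u;q)_{k-\ell}\,v^{k-\ell}x^{\ell}. \end{align*} Then \begin{equation*} H_{n}(\widetilde{\alpha}_{k}^{u,v}(x))=v^{\binom{n+1}{2}}q^{\binom{n+1}{3}}\prod_{j=1}^{n}(uv q^{j-1}-x)^{n+1-j}(u,q;q)_{n+1-j}. \end{equation*}
   Context: For a sequence $(a_k)_{k\ge0}$, $H_n(a_k):=\det_{0\le i,j\le n}(a_{i+j})$ denotes its $n$-th Hankel determinant. The $q$-Pochhammer symbol is $(A;q)_N:=\prod_{k=0}^{N-1}(1-Aq^k)$, with $(A_1,A_2;q)_N:=(A_1;q)_N(A_2;q)_N$, and the $q$-binomial coefficient is $\genfrac{[}{]}{0pt}{}{n}{k}_q:=\frac{(q;q)_n}{(q;q)_k(q;q)_{n-k}}$ for $0\le k\le n$ and $0$ otherwise. The polynomials $\widetilde{\alpha}_{k}^{u,v}(x)$ arise from the transform $\widetilde{\alpha}_{k}(x)=\sum_{\ell=0}^{k}q^{\binom{\ell}{2}}\genfrac{[}{]}{0pt}{}{k}{\ell}_{q}\alpha_{\ell}x^{k-\ell}$ with the choice $\alpha_{k}=q^{ -\binom{k}{2}}(u;q)_{k}\,v^{k}$. -}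

module Defs where

open import Level using (Level)
open import Algebra.Bundles using (CommutativeRing)
open import Data.Nat using (ℕ; zero; suc; _∸_) renaming (_+_ to _+ℕ_)
open import Data.Fin using (Fin; zero; suc; toℕ; punchIn)

-- Everything is stated over an arbitrary commutative ring R; q u v x are
-- arbitrary elements.  Taking R = ℤ[q,u,v,x] recovers the polynomial identity.
module _ {c ℓ : Level} (R : CommutativeRing c ℓ) where
  open CommutativeRing R hiding (zero)

  _−_ : Carrier → Carrier → Carrier
  a − b = a + (- b)

  pow : Carrier → ℕ → Carrier
  pow a zero    = 1#
  pow a (suc n) = a * pow a n

  sumLt : (ℕ → Carrier) → ℕ → Carrier
  sumLt f zero    = 0#
  sumLt f (suc n) = sumLt f n + f n

  prodLt : (ℕ → Carrier) → ℕ → Carrier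
  prodLt f zero    = 1#
  prodLt f (suc n) = prodLt f n * f n

  sumFin : (n : ℕ) → (Fin n → Carrier) → Carrier
  sumFin zero    f = 0#
  sumFin (suc n) f = f zero + sumFin n (λ i → f (suc i))

  qPoch : Carrier → Carrier → ℕ → Carrier
  qPoch A q N = prodLt (λ k → 1# − (A * pow q k)) N

  qBinom : Carrier → ℕ → ℕ → Carrier
  qBinom q zero    zero    = 1#
  qBinom q zero    (suc k) = 0#
  qBinom q (suc n) zero    = 1#
  qBinom q (suc n) (suc k) = qBinom q n k + (pow q (suc k) * qBinom q n (suc k))

  det : (n : ℕ) → (Fin n → Fin n → Carrier) → Carrier
  det zero    M = 1#
  det (suc n) M =
    sumFin (suc n) (λ j →
      (pow (- 1#) (toℕ j) * M zero j) * det n (λ i k → M (suc i) (punchIn j k)))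

  hankel : (ℕ → Carrier) → ℕ → Carrier
  hankel a n = det (suc n) (λ i j → a (toℕ i +ℕ toℕ j))

  alphaTilde : (q u v x : Carrier) → ℕ → Carrier
  alphaTilde q u v x k =
    sumLt (λ l → ((qBinom q k l * qPoch u q l) * pow v l) * pow x (k ∸ l)) (suc k)

-- Let p_m = Π_{l<m} (X − q^l x) and let L be the linear functional with L(p_m) = (u;q)_m v^m;
-- expanding X^k in the basis p_m shows L(X^k) = α̃_k. The monic polynomials Q_j whose
-- coefficients in the basis p_m are explicit q-hypergeometric terms satisfy a three-term
-- recurrence X Q_j = Q_{j+1} + b_j Q_j + β_{j−1} Q_{j−1} with β_j = v q^j (1 − u q^j)(1 − q^{j+1})(uv q^j − x),
-- and L(Q_j) = 0 for j ≥ 1. Hence, if U is the unit upper-triangular matrix of coefficients of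
-- the Q_j in the monomial basis, H U = (L(X^i Q_j))_{i,j} is lower triangular with diagonal
-- β_0 ⋯ β_{j−1}, so H_n = Π_{j≤n} Π_{l<j} β_l, which rearranges into the stated product.

module Submission where

open import Defs
open import Level using (Level)
open import Algebra.Bundles using (CommutativeRing)
open import Data.Nat as ℕ using (ℕ; zero; suc; _∸_; _≤_; _<_; z≤n; s≤s; _≟_; _<?_)
import Data.Nat.Properties as ℕ
open import Data.Nat.Combinatorics using (_C_)
open import Data.Integer using (+_)
open import Data.Product using (∃; _,_)
open import Data.Sum using (inj₁; inj₂)
open import Data.Fin using (Fin; toℕ; punchIn) renaming (zero to fzero; suc to fsuc)
open import Relation.Nullary using (yes; no; contradiction)
open import Relation.Binary.Definitions using (tri<; tri≈; tri>)
open import Relation.Binary.PropositionalEquality as ≡ using (_≡_; _≢_)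

-- The stdlib ring solver normalises with coefficients from a ring with decidable
-- equality; to use it in an arbitrary commutative ring we interpret integer
-- coefficients through the canonical map ℤ → R.
module IntegerSolver {c ℓ : Level} (R : CommutativeRing c ℓ) where
  open import Data.Integer as ℤ using (ℤ; -[1+_]; _⊖_; _◃_; sign; ∣_∣)
  import Data.Integer.Properties as ℤ
  open import Data.Sign as Sign using (Sign)
  open import Data.Maybe using (Maybe; just; nothing)
  open import Algebra.Solver.Ring.AlmostCommutativeRing using (fromCommutativeRing; _-Raw-AlmostCommutative⟶_)
  open CommutativeRing R
  open import Algebra.Properties.Ring ring using (-‿involutive; -0#≈0#; -‿distribˡ-*; -‿+-comm)
  open import Algebra.Properties.Semiring.Mult.TCOptimised semiring using (_×_; 1+×; ×-homo-+; ×1-homo-*)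
  open import Algebra.Properties.CommutativeSemigroup +-commutativeSemigroup using () renaming (interchange to +-interchange)
  open import Algebra.Properties.CommutativeSemigroup *-commutativeSemigroup using () renaming (interchange to *-interchange)
  open import Relation.Binary.Reasoning.Setoid setoid

  ι : ℤ → Carrier
  ι (+ n)    = n × 1#
  ι -[1+ n ] = - (suc n × 1#)

  ι-⊖ : ∀ m n → ι (m ⊖ n) ≈ m × 1# + - (n × 1#)
  ι-⊖ zero    zero    = sym (trans (+-identityˡ _) -0#≈0#)
  ι-⊖ zero    (suc n) = sym (+-identityˡ _)
  ι-⊖ (suc m) zero    = sym (trans (+-congˡ -0#≈0#) (+-identityʳ _))
  ι-⊖ (suc m) (suc n) = begin
    ι (suc m ⊖ suc n)                       ≡⟨ ≡.cong ι (ℤ.[1+m]⊖[1+n]≡m⊖n m n) ⟩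
    ι (m ⊖ n)                               ≈⟨ ι-⊖ m n ⟩
    m × 1# + - (n × 1#)                     ≈⟨ +-identityˡ _ ⟨
    0# + (m × 1# + - (n × 1#))              ≈⟨ +-congʳ (-‿inverseʳ 1#) ⟨
    (1# + - 1#) + (m × 1# + - (n × 1#))     ≈⟨ +-interchange _ _ _ _ ⟩
    (1# + m × 1#) + (- 1# + - (n × 1#))     ≈⟨ +-congˡ (-‿+-comm _ _) ⟩
    (1# + m × 1#) + - (1# + n × 1#)         ≈⟨ +-cong (1+× m 1#) (-‿cong (1+× n 1#)) ⟨
    suc m × 1# + - (suc n × 1#)             ∎

  ι-+ : ∀ i j → ι (i ℤ.+ j) ≈ ι i + ι j
  ι-+ -[1+ m ] -[1+ n ] = begin
    - (suc (suc (m ℕ.+ n)) × 1#)            ≡⟨ ≡.cong (λ k → - (suc k × 1#)) (ℕ.+-suc m n) ⟨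
    - ((suc m ℕ.+ suc n) × 1#)              ≈⟨ -‿cong (×-homo-+ 1# (suc m) (suc n)) ⟩
    - (suc m × 1# + suc n × 1#)             ≈⟨ -‿+-comm _ _ ⟨
    - (suc m × 1#) + - (suc n × 1#)         ∎
  ι-+ -[1+ m ] (+ n)    = trans (ι-⊖ n (suc m)) (+-comm _ _)
  ι-+ (+ m)    -[1+ n ] = ι-⊖ m (suc n)
  ι-+ (+ m)    (+ n)    = ×-homo-+ 1# m n

  σ : Sign → Carrier
  σ Sign.+ = 1#
  σ Sign.- = - 1#

  σ-* : ∀ s t → σ (s Sign.* t) ≈ σ s * σ t
  σ-* Sign.- Sign.- = sym (trans (sym (-‿distribˡ-* _ _)) (trans (-‿cong (*-identityˡ _)) (-‿involutive _)))
  σ-* Sign.- Sign.+ = sym (*-identityʳ _)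
  σ-* Sign.+ Sign.- = sym (*-identityˡ _)
  σ-* Sign.+ Sign.+ = sym (*-identityˡ _)

  ι-◃ : ∀ s n → ι (s ◃ n) ≈ σ s * (n × 1#)
  ι-◃ Sign.- zero    = sym (zeroʳ _)
  ι-◃ Sign.+ zero    = sym (zeroʳ _)
  ι-◃ Sign.- (suc n) = trans (-‿cong (sym (*-identityˡ _))) (-‿distribˡ-* _ _)
  ι-◃ Sign.+ (suc n) = sym (*-identityˡ _)

  ι-* : ∀ i j → ι (i ℤ.* j) ≈ ι i * ι j
  ι-* i j = begin
    ι (i ℤ.* j)                                                   ≈⟨ ι-◃ (sign i Sign.* sign j) (∣ i ∣ ℕ.* ∣ j ∣) ⟩
    σ (sign i Sign.* sign j) * ((∣ i ∣ ℕ.* ∣ j ∣) × 1#)           ≈⟨ *-cong (σ-* (sign i) (sign j)) (×1-homo-* ∣ i ∣ ∣ j ∣) ⟩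
    (σ (sign i) * σ (sign j)) * ((∣ i ∣ × 1#) * (∣ j ∣ × 1#))     ≈⟨ *-interchange _ _ _ _ ⟩
    (σ (sign i) * (∣ i ∣ × 1#)) * (σ (sign j) * (∣ j ∣ × 1#))     ≈⟨ *-cong (ι-sign∣∣ i) (ι-sign∣∣ j) ⟨
    ι i * ι j                                                     ∎
    where
    ι-sign∣∣ : ∀ i → ι i ≈ σ (sign i) * (∣ i ∣ × 1#)
    ι-sign∣∣ i = trans (reflexive (≡.cong ι (≡.sym (ℤ.◃-inverse i)))) (ι-◃ (sign i) ∣ i ∣)

  ι-neg : ∀ i → ι (ℤ.- i) ≈ - ι i
  ι-neg -[1+ n ]    = sym (-‿involutive _)
  ι-neg (+ zero)    = sym -0#≈0#
  ι-neg (+ suc n)   = refl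

  ι-homomorphism : ℤ.+-*-rawRing -Raw-AlmostCommutative⟶ fromCommutativeRing R
  ι-homomorphism = record
    { ⟦_⟧ = ι ; +-homo = ι-+ ; *-homo = ι-* ; -‿homo = ι-neg ; 0-homo = refl ; 1-homo = refl }

  ι-weaklyDecidable : ∀ i j → Maybe (ι i ≈ ι j)
  ι-weaklyDecidable i j with i ℤ.≟ j
  ... | yes ≡.refl = just refl
  ... | no _       = nothing

  open import Algebra.Solver.Ring ℤ.+-*-rawRing (fromCommutativeRing R) ι-homomorphism ι-weaklyDecidable public

module Sums {c ℓ : Level} (R : CommutativeRing c ℓ) where
  open CommutativeRing R hiding (zero)
  open import Algebra.Properties.Ring ring using (-0#≈0#; -‿+-comm)
  open import Algebra.Properties.CommutativeSemigroup +-commutativeSemigroup using () renaming (interchange to +-interchange)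
  open import Algebra.Properties.CommutativeSemigroup *-commutativeSemigroup using () renaming (interchange to *-interchange)

  Σ< : (ℕ → Carrier) → ℕ → Carrier
  Σ< = sumLt R

  Π< : (ℕ → Carrier) → ℕ → Carrier
  Π< = prodLt R

  infixr 8 _^_
  _^_ : Carrier → ℕ → Carrier
  _^_ = pow R

  sumLt-cong : ∀ {f g} n → (∀ i → i < n → f i ≈ g i) → Σ< f n ≈ Σ< g n
  sumLt-cong zero    f≈g = refl
  sumLt-cong (suc n) f≈g = +-cong (sumLt-cong n (λ i i<n → f≈g i (ℕ.m<n⇒m<1+n i<n))) (f≈g n ℕ.≤-refl)

  sumLt-distrib-+ : ∀ f g n → Σ< (λ i → f i + g i) n ≈ Σ< f n + Σ< g n
  sumLt-distrib-+ f g zero    = sym (+-identityˡ _)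
  sumLt-distrib-+ f g (suc n) = trans (+-congʳ (sumLt-distrib-+ f g n)) (+-interchange _ _ _ _)

  *-distribˡ-sumLt : ∀ k f n → k * Σ< f n ≈ Σ< (λ i → k * f i) n
  *-distribˡ-sumLt k f zero    = zeroʳ k
  *-distribˡ-sumLt k f (suc n) = trans (distribˡ _ _ _) (+-congʳ (*-distribˡ-sumLt k f n))

  *-distribʳ-sumLt : ∀ k f n → Σ< f n * k ≈ Σ< (λ i → f i * k) n
  *-distribʳ-sumLt k f n =
    trans (*-comm _ _) (trans (*-distribˡ-sumLt k f n) (sumLt-cong n (λ _ _ → *-comm _ _)))

  -‿distrib-sumLt : ∀ f n → - Σ< f n ≈ Σ< (λ i → - f i) n
  -‿distrib-sumLt f zero    = -0#≈0#
  -‿distrib-sumLt f (suc n) = trans (sym (-‿+-comm _ _)) (+-congʳ (-‿distrib-sumLt f n))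

  sumLt-zero : ∀ f n → (∀ i → i < n → f i ≈ 0#) → Σ< f n ≈ 0#
  sumLt-zero f zero    f≈0 = refl
  sumLt-zero f (suc n) f≈0 =
    trans (+-cong (sumLt-zero f n (λ i i<n → f≈0 i (ℕ.m<n⇒m<1+n i<n))) (f≈0 n ℕ.≤-refl)) (+-identityˡ _)

  sumLt-shift : ∀ f n → Σ< f (suc n) ≈ f 0 + Σ< (λ i → f (suc i)) n
  sumLt-shift f zero    = trans (+-identityˡ _) (sym (+-identityʳ _))
  sumLt-shift f (suc n) = trans (+-congʳ (sumLt-shift f n)) (+-assoc _ _ _)

  sumLt-extend : ∀ f {n m} → n ≤ m → (∀ i → n ≤ i → f i ≈ 0#) → Σ< f m ≈ Σ< f n
  sumLt-extend f {n} {m} n≤m tail≈0 with ℕ.m≤n⇒m<n∨m≡n n≤m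
  ... | inj₂ ≡.refl = refl
  sumLt-extend f {n} {suc m} n≤m tail≈0 | inj₁ n<1+m =
    trans (+-cong (sumLt-extend f (ℕ.≤-pred n<1+m) tail≈0) (tail≈0 m (ℕ.≤-pred n<1+m))) (+-identityʳ _)

  sumLt-comm : ∀ (f : ℕ → ℕ → Carrier) m n →
               Σ< (λ i → Σ< (f i) n) m ≈ Σ< (λ j → Σ< (λ i → f i j) m) n
  sumLt-comm f zero    n = sym (sumLt-zero _ n (λ _ _ → refl))
  sumLt-comm f (suc m) n = trans (+-congʳ (sumLt-comm f m n)) (sym (sumLt-distrib-+ _ _ n))

  sumLt-single : ∀ f n p → p < n → (∀ i → i < n → i ≢ p → f i ≈ 0#) → Σ< f n ≈ f p
  sumLt-single f (suc n) p p<1+n others≈0 with ℕ.m≤n⇒m<n∨m≡n (ℕ.≤-pred p<1+n)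
  ... | inj₁ p<n    = trans (+-cong (sumLt-single f n p p<n (λ i i<n → others≈0 i (ℕ.m<n⇒m<1+n i<n)))
                                    (others≈0 n ℕ.≤-refl (ℕ.>⇒≢ p<n)))
                            (+-identityʳ _)
  ... | inj₂ ≡.refl = trans (+-congʳ (sumLt-zero f n (λ i i<n → others≈0 i (ℕ.m<n⇒m<1+n i<n) (ℕ.<⇒≢ i<n))))
                            (+-identityˡ _)

  sumLt-pair : ∀ f n p → suc p < n → (∀ i → i < n → i ≢ p → i ≢ suc p → f i ≈ 0#) →
               Σ< f n ≈ f p + f (suc p)
  sumLt-pair f (suc n) p (s≤s 1+p≤n) others≈0 with ℕ.m≤n⇒m<n∨m≡n 1+p≤n
  ... | inj₁ 1+p<n  = trans (+-cong (sumLt-pair f n p 1+p<n (λ i i<n → others≈0 i (ℕ.m<n⇒m<1+n i<n)))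
                                    (others≈0 n ℕ.≤-refl (ℕ.>⇒≢ (ℕ.<-trans (ℕ.n<1+n p) 1+p<n)) (ℕ.>⇒≢ 1+p<n)))
                            (+-identityʳ _)
  ... | inj₂ ≡.refl = +-congʳ (trans (+-congʳ (sumLt-zero f p below-p≈0)) (+-identityˡ _))
    where
    below-p≈0 : ∀ i → i < p → f i ≈ 0#
    below-p≈0 i i<p = others≈0 i (ℕ.<-trans i<p (ℕ.<-trans (ℕ.n<1+n p) (ℕ.n<1+n _)))
                               (ℕ.<⇒≢ i<p) (ℕ.<⇒≢ (ℕ.<-trans i<p (ℕ.n<1+n p)))

  prodLt-cong : ∀ {f g} n → (∀ i → i < n → f i ≈ g i) → Π< f n ≈ Π< g n
  prodLt-cong zero    f≈g = refl
  prodLt-cong (suc n) f≈g = *-cong (prodLt-cong n (λ i i<n → f≈g i (ℕ.m<n⇒m<1+n i<n))) (f≈g n ℕ.≤-refl)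

  prodLt-shift : ∀ f n → Π< f (suc n) ≈ f 0 * Π< (λ i → f (suc i)) n
  prodLt-shift f zero    = trans (*-identityˡ _) (sym (*-identityʳ _))
  prodLt-shift f (suc n) = trans (*-congʳ (prodLt-shift f n)) (*-assoc _ _ _)

  prodLt-distrib-* : ∀ f g n → Π< (λ i → f i * g i) n ≈ Π< f n * Π< g n
  prodLt-distrib-* f g zero    = sym (*-identityˡ _)
  prodLt-distrib-* f g (suc n) = trans (*-congʳ (prodLt-distrib-* f g n)) (*-interchange _ _ _ _)

  prodLt-const : ∀ k n → Π< (λ _ → k) n ≈ k ^ n
  prodLt-const k zero    = refl
  prodLt-const k (suc n) = trans (*-congʳ (prodLt-const k n)) (*-comm _ _)

  prodLt-reverse : ∀ f n → Π< (λ i → f (n ∸ i)) (suc n) ≈ Π< f (suc n)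
  prodLt-reverse f zero    = refl
  prodLt-reverse f (suc n) = trans (prodLt-shift _ (suc n)) (trans (*-congˡ (prodLt-reverse f n)) (*-comm _ _))

  pow-congˡ : ∀ {a b} n → a ≈ b → a ^ n ≈ b ^ n
  pow-congˡ zero    a≈b = refl
  pow-congˡ (suc n) a≈b = *-cong a≈b (pow-congˡ n a≈b)

  pow-homo-* : ∀ a m n → a ^ (m ℕ.+ n) ≈ a ^ m * a ^ n
  pow-homo-* a zero    n = sym (*-identityˡ _)
  pow-homo-* a (suc m) n = trans (*-congˡ (pow-homo-* a m n)) (sym (*-assoc _ _ _))

  pow-distrib-* : ∀ a b n → (a * b) ^ n ≈ a ^ n * b ^ n
  pow-distrib-* a b zero    = sym (*-identityˡ _)
  pow-distrib-* a b (suc n) = trans (*-congˡ (pow-distrib-* a b n)) (*-interchange _ _ _ _)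

module Determinant {c ℓ : Level} (R : CommutativeRing c ℓ) where
  open CommutativeRing R hiding (zero)
  open import Algebra.Properties.Ring ring using (-0#≈0#; -‿involutive)
  open import Relation.Binary.Reasoning.Setoid setoid
  open IntegerSolver R using (solve; _:=_; _:+_; _:*_; :-_; con)
  open Sums R

  Matrix : Set c
  Matrix = ℕ → ℕ → Carrier

  punchInℕ : ℕ → ℕ → ℕ
  punchInℕ zero    k       = suc k
  punchInℕ (suc j) zero    = zero
  punchInℕ (suc j) (suc k) = suc (punchInℕ j k)

  alternating : ℕ → Carrier
  alternating zero    = 1#
  alternating (suc j) = - alternating j

  minor : ℕ → Matrix → Matrix
  minor j M i k = M (suc i) (punchInℕ j k)

  det′ : ℕ → Matrix → Carrier
  laplaceTerm : ℕ → Matrix → ℕ → Carrier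

  det′ zero    M = 1#
  det′ (suc n) M = Σ< (laplaceTerm n M) (suc n)

  laplaceTerm n M j = (alternating j * M 0 j) * det′ n (minor j M)

  punchInℕ-≤ : ∀ j k → punchInℕ j k ≤ suc k
  punchInℕ-≤ zero    k       = ℕ.≤-refl
  punchInℕ-≤ (suc j) zero    = z≤n
  punchInℕ-≤ (suc j) (suc k) = s≤s (punchInℕ-≤ j k)

  punchInℕ-≢ : ∀ j k → punchInℕ j k ≢ j
  punchInℕ-≢ zero    k       ()
  punchInℕ-≢ (suc j) zero    ()
  punchInℕ-≢ (suc j) (suc k) e = punchInℕ-≢ j k (ℕ.suc-injective e)

  punchInℕ-injective : ∀ j k l → punchInℕ j k ≡ punchInℕ j l → k ≡ l
  punchInℕ-injective zero    k       l       e  = ℕ.suc-injective e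
  punchInℕ-injective (suc j) zero    zero    e  = ≡.refl
  punchInℕ-injective (suc j) (suc k) (suc l) e  = ≡.cong suc (punchInℕ-injective j k l (ℕ.suc-injective e))

  punchInℕ-surjective : ∀ j r → j ≢ r → ∃ λ r′ → punchInℕ j r′ ≡ r
  punchInℕ-surjective zero    zero    j≢r = contradiction ≡.refl j≢r
  punchInℕ-surjective zero    (suc r) j≢r = r , ≡.refl
  punchInℕ-surjective (suc j) zero    j≢r = zero , ≡.refl
  punchInℕ-surjective (suc j) (suc r) j≢r with punchInℕ-surjective j r (λ e → j≢r (≡.cong suc e))
  ... | r′ , e = suc r′ , ≡.cong suc e

  punchInℕ-<-reflect : ∀ j k n → j ≤ n → punchInℕ j k < suc n → k < n
  punchInℕ-<-reflect zero    k       n       j≤n       (s≤s k<n) = k<n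
  punchInℕ-<-reflect (suc j) zero    (suc n) j≤n       _         = s≤s z≤n
  punchInℕ-<-reflect (suc j) (suc k) (suc n) (s≤s j≤n) (s≤s lt)  = s≤s (punchInℕ-<-reflect j k n j≤n lt)

  punchInℕ-< : ∀ j k → k < j → punchInℕ j k ≡ k
  punchInℕ-< (suc j) zero    _         = ≡.refl
  punchInℕ-< (suc j) (suc k) (s≤s k<j) = ≡.cong suc (punchInℕ-< j k k<j)

  punchInℕ-≥ : ∀ j k → j ≤ k → punchInℕ j k ≡ suc k
  punchInℕ-≥ zero    k       _         = ≡.refl
  punchInℕ-≥ (suc j) (suc k) (s≤s j≤k) = ≡.cong suc (punchInℕ-≥ j k j≤k)

  det′-cong : ∀ n {M N : Matrix} → (∀ i k → k < n → M i k ≈ N i k) → det′ n M ≈ det′ n N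
  det′-cong zero    M≈N = refl
  det′-cong (suc n) M≈N = sumLt-cong (suc n) λ j j<1+n →
    *-cong (*-congˡ (M≈N 0 j j<1+n))
           (det′-cong n (λ i k k<n → M≈N (suc i) (punchInℕ j k) (ℕ.≤-<-trans (punchInℕ-≤ j k) (s≤s k<n))))

  det′-linearColumn : ∀ n r (A B M : Matrix) α → r < n →
    (∀ i → M i r ≈ A i r + α * B i r) →
    (∀ i k → k ≢ r → A i k ≈ M i k) → (∀ i k → k ≢ r → B i k ≈ M i k) →
    det′ n M ≈ det′ n A + α * det′ n B
  det′-linearColumn (suc n) r A B M α r<1+n Mᵣ≈ A≈M B≈M =
    trans (sumLt-cong (suc n) term)
          (trans (sumLt-distrib-+ _ _ (suc n)) (+-congˡ (sym (*-distribˡ-sumLt α _ (suc n)))))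
    where
    term : ∀ j → j < suc n → laplaceTerm n M j ≈ laplaceTerm n A j + α * laplaceTerm n B j
    term j j<1+n with j ≟ r
    ... | yes ≡.refl = begin
      (alternating j * M 0 j) * det′ n (minor j M)
        ≈⟨ *-cong (*-congˡ (Mᵣ≈ 0)) (det′-cong n (λ i k _ → sym (A≈M (suc i) (punchInℕ j k) (punchInℕ-≢ j k)))) ⟩
      (alternating j * (A 0 j + α * B 0 j)) * det′ n (minor j A)
        ≈⟨ solve 5 (λ s a b d e → (s :* (a :+ e :* b)) :* d := (s :* a) :* d :+ e :* ((s :* b) :* d)) refl _ _ _ _ _ ⟩
      laplaceTerm n A j + α * ((alternating j * B 0 j) * det′ n (minor j A))
        ≈⟨ +-congˡ (*-congˡ (*-congˡ (det′-cong n (λ i k _ → minorA≈minorB i k)))) ⟩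
      laplaceTerm n A j + α * laplaceTerm n B j ∎
      where
      minorA≈minorB : ∀ i k → minor j A i k ≈ minor j B i k
      minorA≈minorB i k = trans (A≈M (suc i) _ (punchInℕ-≢ j k)) (sym (B≈M (suc i) _ (punchInℕ-≢ j k)))
    ... | no j≢r with punchInℕ-surjective j r j≢r
    ...   | r′ , e = begin
      (alternating j * M 0 j) * det′ n (minor j M)
        ≈⟨ *-congˡ minor-linear ⟩
      (alternating j * M 0 j) * (det′ n (minor j A) + α * det′ n (minor j B))
        ≈⟨ solve 5 (λ s c d f e → (s :* c) :* (d :+ e :* f) := (s :* c) :* d :+ e :* ((s :* c) :* f)) refl _ _ _ _ _ ⟩
      (alternating j * M 0 j) * det′ n (minor j A) + α * ((alternating j * M 0 j) * det′ n (minor j B))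
        ≈⟨ +-cong (*-congʳ (*-congˡ (sym (A≈M 0 j j≢r)))) (*-congˡ (*-congʳ (*-congˡ (sym (B≈M 0 j j≢r))))) ⟩
      laplaceTerm n A j + α * laplaceTerm n B j ∎
      where
      r′<n : r′ < n
      r′<n = punchInℕ-<-reflect j r′ n (ℕ.≤-pred j<1+n) (≡.subst (_< suc n) (≡.sym e) r<1+n)
      off : ∀ k → k ≢ r′ → punchInℕ j k ≢ r
      off k k≢r′ e′ = k≢r′ (punchInℕ-injective j k r′ (≡.trans e′ (≡.sym e)))
      minor-linear : det′ n (minor j M) ≈ det′ n (minor j A) + α * det′ n (minor j B)
      minor-linear = det′-linearColumn n r′ (minor j A) (minor j B) (minor j M) α r′<n
        (λ i → ≡.subst (λ z → M (suc i) z ≈ A (suc i) z + α * B (suc i) z) (≡.sym e) (Mᵣ≈ (suc i)))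
        (λ i k k≢r′ → A≈M (suc i) (punchInℕ j k) (off k k≢r′))
        (λ i k k≢r′ → B≈M (suc i) (punchInℕ j k) (off k k≢r′))

  adjSwap : ℕ → ℕ → ℕ
  adjSwap zero    zero          = 1
  adjSwap zero    (suc zero)    = 0
  adjSwap zero    (suc (suc k)) = suc (suc k)
  adjSwap (suc p) zero          = zero
  adjSwap (suc p) (suc k)       = suc (adjSwap p k)

  adjSwap-< : ∀ p j → j < p → adjSwap p j ≡ j
  adjSwap-< (suc p) zero    _         = ≡.refl
  adjSwap-< (suc p) (suc j) (s≤s j<p) = ≡.cong suc (adjSwap-< p j j<p)

  adjSwap-> : ∀ p j → suc p < j → adjSwap p j ≡ j
  adjSwap-> zero    (suc zero)    (s≤s ())
  adjSwap-> zero    (suc (suc j)) _          = ≡.refl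
  adjSwap-> (suc p) (suc j)       (s≤s 1+p<j) = ≡.cong suc (adjSwap-> p j 1+p<j)

  adjSwap-left : ∀ p → adjSwap p p ≡ suc p
  adjSwap-left zero    = ≡.refl
  adjSwap-left (suc p) = ≡.cong suc (adjSwap-left p)

  adjSwap-right : ∀ p → adjSwap p (suc p) ≡ p
  adjSwap-right zero    = ≡.refl
  adjSwap-right (suc p) = ≡.cong suc (adjSwap-right p)

  adjSwap-punchInℕ-> : ∀ p j k → suc p < j → adjSwap p (punchInℕ j k) ≡ punchInℕ j (adjSwap p k)
  adjSwap-punchInℕ-> zero    (suc zero)    k             (s≤s ())
  adjSwap-punchInℕ-> zero    (suc (suc j)) zero          _           = ≡.refl
  adjSwap-punchInℕ-> zero    (suc (suc j)) (suc zero)    _           = ≡.refl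
  adjSwap-punchInℕ-> zero    (suc (suc j)) (suc (suc k)) _           = ≡.refl
  adjSwap-punchInℕ-> (suc p) (suc j)       zero          _           = ≡.refl
  adjSwap-punchInℕ-> (suc p) (suc j)       (suc k)       (s≤s 1+p<j) = ≡.cong suc (adjSwap-punchInℕ-> p j k 1+p<j)

  adjSwap-punchInℕ-≤ : ∀ p j k → j ≤ p → adjSwap (suc p) (punchInℕ j k) ≡ punchInℕ j (adjSwap p k)
  adjSwap-punchInℕ-≤ p       zero    k       _         = ≡.refl
  adjSwap-punchInℕ-≤ (suc p) (suc j) zero    _         = ≡.refl
  adjSwap-punchInℕ-≤ (suc p) (suc j) (suc k) (s≤s j≤p) = ≡.cong suc (adjSwap-punchInℕ-≤ p j k j≤p)

  adjSwap-punchInℕ-left : ∀ p k → adjSwap p (punchInℕ p k) ≡ punchInℕ (suc p) k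
  adjSwap-punchInℕ-left zero    zero    = ≡.refl
  adjSwap-punchInℕ-left zero    (suc k) = ≡.refl
  adjSwap-punchInℕ-left (suc p) zero    = ≡.refl
  adjSwap-punchInℕ-left (suc p) (suc k) = ≡.cong suc (adjSwap-punchInℕ-left p k)

  adjSwap-punchInℕ-right : ∀ p k → adjSwap p (punchInℕ (suc p) k) ≡ punchInℕ p k
  adjSwap-punchInℕ-right zero    zero    = ≡.refl
  adjSwap-punchInℕ-right zero    (suc k) = ≡.refl
  adjSwap-punchInℕ-right (suc p) zero    = ≡.refl
  adjSwap-punchInℕ-right (suc p) (suc k) = ≡.cong suc (adjSwap-punchInℕ-right p k)

  sumLt-adjSwap : ∀ f n p → suc p < n → Σ< (λ j → f (adjSwap p j)) n ≈ Σ< f n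
  sumLt-adjSwap f (suc n) p (s≤s 1+p≤n) with ℕ.m≤n⇒m<n∨m≡n 1+p≤n
  ... | inj₁ 1+p<n  = +-cong (sumLt-adjSwap f n p 1+p<n) (reflexive (≡.cong f (adjSwap-> p n 1+p<n)))
  ... | inj₂ ≡.refl = begin
    (Σ< (λ j → f (adjSwap p j)) p + f (adjSwap p p)) + f (adjSwap p (suc p))
      ≈⟨ +-cong (+-cong (sumLt-cong p (λ i i<p → reflexive (≡.cong f (adjSwap-< p i i<p))))
                        (reflexive (≡.cong f (adjSwap-left p))))
                (reflexive (≡.cong f (adjSwap-right p))) ⟩
    (Σ< f p + f (suc p)) + f p
      ≈⟨ solve 3 (λ a b c → (a :+ b) :+ c := (a :+ c) :+ b) refl _ _ _ ⟩
    (Σ< f p + f p) + f (suc p) ∎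

  swapColumns : ℕ → Matrix → Matrix
  swapColumns p M i k = M i (adjSwap p k)

  det′-swapColumns : ∀ n p (M : Matrix) → suc p < n → det′ n (swapColumns p M) ≈ - det′ n M
  laplaceTerm-swapColumns : ∀ n p (M : Matrix) → suc p < suc n → ∀ j → j < suc n →
                            laplaceTerm n (swapColumns p M) j ≈ - laplaceTerm n M (adjSwap p j)
  laplaceTerm-swapInMinor : ∀ n p p′ (M : Matrix) j → suc p′ < n → adjSwap p j ≡ j →
                            (∀ k → adjSwap p (punchInℕ j k) ≡ punchInℕ j (adjSwap p′ k)) →
                            laplaceTerm n (swapColumns p M) j ≈ - laplaceTerm n M (adjSwap p j)

  det′-swapColumns (suc n) p M 1+p<1+n = begin
    Σ< (laplaceTerm n (swapColumns p M)) (suc n)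
      ≈⟨ sumLt-cong (suc n) (laplaceTerm-swapColumns n p M 1+p<1+n) ⟩
    Σ< (λ j → - laplaceTerm n M (adjSwap p j)) (suc n)
      ≈⟨ -‿distrib-sumLt _ (suc n) ⟨
    - Σ< (λ j → laplaceTerm n M (adjSwap p j)) (suc n)
      ≈⟨ -‿cong (sumLt-adjSwap (laplaceTerm n M) (suc n) p 1+p<1+n) ⟩
    - det′ (suc n) M ∎

  laplaceTerm-swapColumns n p M 1+p<1+n j j<1+n with ℕ.<-cmp j p
  laplaceTerm-swapColumns n (suc p) M 1+p<1+n j j<1+n | tri< j<1+p _ _ =
    laplaceTerm-swapInMinor n (suc p) p M j (ℕ.≤-pred 1+p<1+n) (adjSwap-< (suc p) j j<1+p)
                            (λ k → adjSwap-punchInℕ-≤ p j k (ℕ.≤-pred j<1+p))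
  laplaceTerm-swapColumns n p M 1+p<1+n j j<1+n | tri≈ _ ≡.refl _ = begin
    (alternating j * M 0 (adjSwap j j)) * det′ n (minor j (swapColumns j M))
      ≈⟨ *-cong (*-congˡ (reflexive (≡.cong (M 0) (adjSwap-left j))))
                (det′-cong n (λ i k _ → reflexive (≡.cong (M (suc i)) (adjSwap-punchInℕ-left j k)))) ⟩
    (alternating j * M 0 (suc j)) * det′ n (minor (suc j) M)
      ≈⟨ solve 3 (λ s a d → (s :* a) :* d := :- (((:- s) :* a) :* d)) refl _ _ _ ⟩
    - laplaceTerm n M (suc j)
      ≡⟨ ≡.cong (λ z → - laplaceTerm n M z) (adjSwap-left j) ⟨
    - laplaceTerm n M (adjSwap j j) ∎
  laplaceTerm-swapColumns n p M 1+p<1+n j j<1+n | tri> _ _ p<j with ℕ.m≤n⇒m<n∨m≡n p<j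
  ... | inj₁ 1+p<j  = laplaceTerm-swapInMinor n p p M j (ℕ.<-≤-trans 1+p<j (ℕ.≤-pred j<1+n)) (adjSwap-> p j 1+p<j)
                                              (λ k → adjSwap-punchInℕ-> p j k 1+p<j)
  ... | inj₂ ≡.refl = begin
    (alternating (suc p) * M 0 (adjSwap p (suc p))) * det′ n (minor (suc p) (swapColumns p M))
      ≈⟨ *-cong (*-congˡ (reflexive (≡.cong (M 0) (adjSwap-right p))))
                (det′-cong n (λ i k _ → reflexive (≡.cong (M (suc i)) (adjSwap-punchInℕ-right p k)))) ⟩
    (- alternating p * M 0 p) * det′ n (minor p M)
      ≈⟨ solve 3 (λ s a d → ((:- s) :* a) :* d := :- ((s :* a) :* d)) refl _ _ _ ⟩
    - laplaceTerm n M p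
      ≡⟨ ≡.cong (λ z → - laplaceTerm n M z) (adjSwap-right p) ⟨
    - laplaceTerm n M (adjSwap p (suc p)) ∎

  laplaceTerm-swapInMinor n p p′ M j 1+p′<n fixed commutes = begin
    (alternating j * M 0 (adjSwap p j)) * det′ n (minor j (swapColumns p M))
      ≈⟨ *-cong (*-congˡ (reflexive (≡.cong (M 0) fixed)))
                (det′-cong n (λ i k _ → reflexive (≡.cong (M (suc i)) (commutes k)))) ⟩
    (alternating j * M 0 j) * det′ n (swapColumns p′ (minor j M))
      ≈⟨ *-congˡ (det′-swapColumns n p′ (minor j M) 1+p′<n) ⟩
    (alternating j * M 0 j) * (- det′ n (minor j M))
      ≈⟨ solve 2 (λ a b → a :* (:- b) := :- (a :* b)) refl _ _ ⟩
    - laplaceTerm n M j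
      ≡⟨ ≡.cong (λ z → - laplaceTerm n M z) fixed ⟨
    - laplaceTerm n M (adjSwap p j) ∎

  det′-equalAdjacentColumns : ∀ n p (M : Matrix) → suc p < n → (∀ i → M i p ≈ M i (suc p)) → det′ n M ≈ 0#
  minor-equalAdjacentColumns : ∀ n p j (M : Matrix) → j < suc n → j ≢ p → j ≢ suc p → suc p < suc n →
                               (∀ i → M i p ≈ M i (suc p)) → det′ n (minor j M) ≈ 0#

  det′-equalAdjacentColumns (suc n) p M 1+p<1+n Mₚ≈ =
    trans (sumLt-pair (laplaceTerm n M) (suc n) p 1+p<1+n others) pair-cancels
    where
    others : ∀ j → j < suc n → j ≢ p → j ≢ suc p → laplaceTerm n M j ≈ 0#
    others j j<1+n j≢p j≢1+p =
      trans (*-congˡ (minor-equalAdjacentColumns n p j M j<1+n j≢p j≢1+p 1+p<1+n Mₚ≈)) (zeroʳ _)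
    minors≈ : ∀ i k → minor p M i k ≈ minor (suc p) M i k
    minors≈ i k with ℕ.<-cmp k p
    ... | tri< k<p _ _ = reflexive (≡.cong (M (suc i))
            (≡.trans (punchInℕ-< p k k<p) (≡.sym (punchInℕ-< (suc p) k (ℕ.m<n⇒m<1+n k<p)))))
    ... | tri≈ _ ≡.refl _ = trans (reflexive (≡.cong (M (suc i)) (punchInℕ-≥ k k ℕ.≤-refl)))
            (trans (sym (Mₚ≈ (suc i))) (reflexive (≡.cong (M (suc i)) (≡.sym (punchInℕ-< (suc k) k ℕ.≤-refl)))))
    ... | tri> _ _ p<k = reflexive (≡.cong (M (suc i))
            (≡.trans (punchInℕ-≥ p k (ℕ.<⇒≤ p<k)) (≡.sym (punchInℕ-≥ (suc p) k p<k))))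
    pair-cancels : laplaceTerm n M p + laplaceTerm n M (suc p) ≈ 0#
    pair-cancels = begin
      (alternating p * M 0 p) * det′ n (minor p M) + (- alternating p * M 0 (suc p)) * det′ n (minor (suc p) M)
        ≈⟨ +-cong (*-congʳ (*-congˡ (Mₚ≈ 0))) (*-congˡ (sym (det′-cong n (λ i k _ → minors≈ i k)))) ⟩
      (alternating p * M 0 (suc p)) * det′ n (minor p M) + (- alternating p * M 0 (suc p)) * det′ n (minor p M)
        ≈⟨ solve 3 (λ s a d → (s :* a) :* d :+ ((:- s) :* a) :* d := con (+ 0)) refl _ _ _ ⟩
      0# ∎

  minor-equalAdjacentColumns n p j M j<1+n j≢p j≢1+p 1+p<1+n Mₚ≈ with ℕ.<-cmp j p
  ... | tri≈ _ j≡p _ = contradiction j≡p j≢p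
  minor-equalAdjacentColumns n (suc p) j M j<1+n j≢p j≢1+p 1+p<1+n Mₚ≈ | tri< j<1+p _ _ =
    det′-equalAdjacentColumns n p (minor j M) (ℕ.≤-pred 1+p<1+n) minorₚ≈
    where
    j≤p = ℕ.≤-pred j<1+p
    minorₚ≈ : ∀ i → minor j M i p ≈ minor j M i (suc p)
    minorₚ≈ i = begin
      M (suc i) (punchInℕ j p)       ≡⟨ ≡.cong (M (suc i)) (punchInℕ-≥ j p j≤p) ⟩
      M (suc i) (suc p)              ≈⟨ Mₚ≈ (suc i) ⟩
      M (suc i) (suc (suc p))        ≡⟨ ≡.cong (M (suc i)) (punchInℕ-≥ j (suc p) (ℕ.m≤n⇒m≤1+n j≤p)) ⟨
      M (suc i) (punchInℕ j (suc p)) ∎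
  minor-equalAdjacentColumns n p j M j<1+n j≢p j≢1+p 1+p<1+n Mₚ≈ | tri> _ _ p<j =
    det′-equalAdjacentColumns n p (minor j M) (ℕ.<-≤-trans 1+p<j (ℕ.≤-pred j<1+n)) minorₚ≈
    where
    1+p<j : suc p < j
    1+p<j = ℕ.≤∧≢⇒< p<j (λ e → j≢1+p (≡.sym e))
    minorₚ≈ : ∀ i → minor j M i p ≈ minor j M i (suc p)
    minorₚ≈ i = begin
      M (suc i) (punchInℕ j p)       ≡⟨ ≡.cong (M (suc i)) (punchInℕ-< j p p<j) ⟩
      M (suc i) p                    ≈⟨ Mₚ≈ (suc i) ⟩
      M (suc i) (suc p)              ≡⟨ ≡.cong (M (suc i)) (punchInℕ-< j (suc p) 1+p<j) ⟨
      M (suc i) (punchInℕ j (suc p)) ∎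

  det′-equalColumns-< : ∀ n p r (M : Matrix) → p < r → r < n → (∀ i → M i p ≈ M i r) → det′ n M ≈ 0#
  det′-equalColumns-< n p (suc r) M p<1+r 1+r<n Mₚ≈ with ℕ.m≤n⇒m<n∨m≡n (ℕ.≤-pred p<1+r)
  ... | inj₂ ≡.refl = det′-equalAdjacentColumns n p M 1+r<n Mₚ≈
  ... | inj₁ p<r    = begin
    det′ n M                     ≈⟨ -‿involutive _ ⟨
    - (- det′ n M)               ≈⟨ -‿cong (det′-swapColumns n r M 1+r<n) ⟨
    - det′ n (swapColumns r M)   ≈⟨ -‿cong (det′-equalColumns-< n p r (swapColumns r M) p<r (ℕ.<-trans (ℕ.n<1+n r) 1+r<n) swappedₚ≈) ⟩
    - 0#                         ≈⟨ -0#≈0# ⟩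
    0#                           ∎
    where
    swappedₚ≈ : ∀ i → M i (adjSwap r p) ≈ M i (adjSwap r r)
    swappedₚ≈ i = begin
      M i (adjSwap r p)  ≡⟨ ≡.cong (M i) (adjSwap-< r p p<r) ⟩
      M i p              ≈⟨ Mₚ≈ i ⟩
      M i (suc r)        ≡⟨ ≡.cong (M i) (adjSwap-left r) ⟨
      M i (adjSwap r r)  ∎

  det′-equalColumns : ∀ n p r (M : Matrix) → p ≢ r → p < n → r < n → (∀ i → M i p ≈ M i r) → det′ n M ≈ 0#
  det′-equalColumns n p r M p≢r p<n r<n Mₚ≈Mᵣ with ℕ.<-cmp p r
  ... | tri< p<r _ _ = det′-equalColumns-< n p r M p<r r<n Mₚ≈Mᵣ
  ... | tri≈ _ p≡r _ = contradiction p≡r p≢r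
  ... | tri> _ _ r<p = det′-equalColumns-< n r p M r<p p<n (λ i → sym (Mₚ≈Mᵣ i))

  replaceColumn : ℕ → (ℕ → Carrier) → Matrix → Matrix
  replaceColumn r v M i k with k ≟ r
  ... | yes _ = v i
  ... | no  _ = M i k

  replaceColumn-same : ∀ r v M i → replaceColumn r v M i r ≈ v i
  replaceColumn-same r v M i with r ≟ r
  ... | yes _   = refl
  ... | no  r≢r = contradiction ≡.refl r≢r

  replaceColumn-other : ∀ r v M i k → k ≢ r → replaceColumn r v M i k ≈ M i k
  replaceColumn-other r v M i k k≢r with k ≟ r
  ... | yes k≡r = contradiction k≡r k≢r
  ... | no  _   = refl

  det′-addColumnMultiple : ∀ n r p (M N : Matrix) α → p < n → r < n → p ≢ r →
    (∀ i → M i r ≈ N i r + α * N i p) → (∀ i k → k ≢ r → N i k ≈ M i k) → det′ n M ≈ det′ n N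
  det′-addColumnMultiple n r p M N α p<n r<n p≢r Mᵣ≈ N≈M = begin
    det′ n M                  ≈⟨ det′-linearColumn n r N B M α r<n Mᵣ≈′ N≈M B≈M ⟩
    det′ n N + α * det′ n B   ≈⟨ +-congˡ (*-congˡ (det′-equalColumns n p r B p≢r p<n r<n Bₚ≈Bᵣ)) ⟩
    det′ n N + α * 0#         ≈⟨ trans (+-congˡ (zeroʳ α)) (+-identityʳ _) ⟩
    det′ n N                  ∎
    where
    B = replaceColumn r (λ i → N i p) N
    Mᵣ≈′ : ∀ i → M i r ≈ N i r + α * B i r
    Mᵣ≈′ i = trans (Mᵣ≈ i) (+-congˡ (*-congˡ (sym (replaceColumn-same r _ N i))))
    B≈M : ∀ i k → k ≢ r → B i k ≈ M i k
    B≈M i k k≢r = trans (replaceColumn-other r _ N i k k≢r) (N≈M i k k≢r)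
    Bₚ≈Bᵣ : ∀ i → B i p ≈ B i r
    Bₚ≈Bᵣ i = trans (replaceColumn-other r _ N i p p≢r) (sym (replaceColumn-same r _ N i))

  det′-addColumnCombination : ∀ s n r (M N : Matrix) (g : ℕ → Carrier) → r < n → s ≤ r →
    (∀ i → M i r ≈ N i r + Σ< (λ k → g k * N i k) s) → (∀ i k → k ≢ r → N i k ≈ M i k) →
    det′ n M ≈ det′ n N
  det′-addColumnCombination zero n r M N g r<n _ Mᵣ≈ N≈M = det′-cong n (λ i k _ → M≈N i k)
    where
    M≈N : ∀ i k → M i k ≈ N i k
    M≈N i k with k ≟ r
    ... | yes ≡.refl = trans (Mᵣ≈ i) (+-identityʳ _)
    ... | no  k≢r    = sym (N≈M i k k≢r)
  det′-addColumnCombination (suc s) n r M N g r<n s<r Mᵣ≈ N≈M =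
    trans (det′-addColumnMultiple n r s M D (g s) (ℕ.<-trans s<r r<n) r<n s≢r Mᵣ≈D D≈M)
          (det′-addColumnCombination s n r D N g r<n (ℕ.<⇒≤ s<r) (replaceColumn-same r _ N) N≈D)
    where
    s≢r = ℕ.<⇒≢ s<r
    D = replaceColumn r (λ i → N i r + Σ< (λ k → g k * N i k) s) N
    Mᵣ≈D : ∀ i → M i r ≈ D i r + g s * D i s
    Mᵣ≈D i = trans (Mᵣ≈ i) (trans (sym (+-assoc _ _ _))
               (+-cong (sym (replaceColumn-same r _ N i)) (*-congˡ (sym (replaceColumn-other r _ N i s s≢r)))))
    D≈M : ∀ i k → k ≢ r → D i k ≈ M i k
    D≈M i k k≢r = trans (replaceColumn-other r _ N i k k≢r) (N≈M i k k≢r)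
    N≈D : ∀ i k → k ≢ r → N i k ≈ D i k
    N≈D i k k≢r = sym (replaceColumn-other r _ N i k k≢r)

  prefixColumns : ℕ → Matrix → Matrix → Matrix
  prefixColumns s A B i k with k <? s
  ... | yes _ = A i k
  ... | no  _ = B i k

  prefixColumns-< : ∀ s A B i k → k < s → prefixColumns s A B i k ≈ A i k
  prefixColumns-< s A B i k k<s with k <? s
  ... | yes _   = refl
  ... | no  k≮s = contradiction k<s k≮s

  prefixColumns-≥ : ∀ s A B i k → s ≤ k → prefixColumns s A B i k ≈ B i k
  prefixColumns-≥ s A B i k s≤k with k <? s
  ... | yes k<s = contradiction s≤k (ℕ.<⇒≱ k<s)
  ... | no  _   = refl

  -- Columns of M · U are turned back into columns of M one at a time, left to right.
  det′-*-unitUpperTriangular : ∀ n (M U : Matrix) → (∀ j → U j j ≈ 1#) →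
    det′ n (λ i j → Σ< (λ k → M i k * U k j) (suc j)) ≈ det′ n M
  det′-*-unitUpperTriangular n M U Uⱼⱼ≈1 = begin
    det′ n MU                   ≈⟨ det′-cong n (λ i k _ → sym (prefixColumns-≥ 0 M MU i k z≤n)) ⟩
    det′ n (P 0)                ≈⟨ prefix-invariant n ℕ.≤-refl ⟩
    det′ n (P n)                ≈⟨ det′-cong n (λ i k k<n → prefixColumns-< n M MU i k k<n) ⟩
    det′ n M                    ∎
    where
    MU : Matrix
    MU i j = Σ< (λ k → M i k * U k j) (suc j)
    P : ℕ → Matrix
    P s = prefixColumns s M MU
    step : ∀ s → s < n → det′ n (P s) ≈ det′ n (P (suc s))
    step s s<n = det′-addColumnCombination s n s (P s) (P (suc s)) (λ k → U k s) s<n ℕ.≤-refl Pₛ≈ P≈P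
      where
      Pₛ≈ : ∀ i → P s i s ≈ P (suc s) i s + Σ< (λ k → U k s * P (suc s) i k) s
      Pₛ≈ i = begin
        P s i s                                       ≈⟨ prefixColumns-≥ s M MU i s ℕ.≤-refl ⟩
        Σ< (λ k → M i k * U k s) s + M i s * U s s    ≈⟨ +-cong (sumLt-cong s earlier) (trans (*-congˡ (Uⱼⱼ≈1 s)) (*-identityʳ _)) ⟩
        Σ< (λ k → U k s * P (suc s) i k) s + M i s    ≈⟨ +-comm _ _ ⟩
        M i s + Σ< (λ k → U k s * P (suc s) i k) s    ≈⟨ +-congʳ (sym (prefixColumns-< (suc s) M MU i s ℕ.≤-refl)) ⟩
        P (suc s) i s + Σ< (λ k → U k s * P (suc s) i k) s ∎
        where
        earlier : ∀ k → k < s → M i k * U k s ≈ U k s * P (suc s) i k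
        earlier k k<s = trans (*-comm _ _) (*-congˡ (sym (prefixColumns-< (suc s) M MU i k (ℕ.m<n⇒m<1+n k<s))))
      P≈P : ∀ i k → k ≢ s → P (suc s) i k ≈ P s i k
      P≈P i k k≢s with ℕ.<-cmp k s
      ... | tri< k<s _ _ = trans (prefixColumns-< (suc s) M MU i k (ℕ.m<n⇒m<1+n k<s)) (sym (prefixColumns-< s M MU i k k<s))
      ... | tri≈ _ k≡s _ = contradiction k≡s k≢s
      ... | tri> _ _ s<k = trans (prefixColumns-≥ (suc s) M MU i k s<k) (sym (prefixColumns-≥ s M MU i k (ℕ.<⇒≤ s<k)))
    prefix-invariant : ∀ s → s ≤ n → det′ n (P 0) ≈ det′ n (P s)
    prefix-invariant zero    _     = refl
    prefix-invariant (suc s) 1+s≤n = trans (prefix-invariant s (ℕ.<⇒≤ 1+s≤n)) (step s 1+s≤n)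

  det′-lowerTriangular : ∀ n (M : Matrix) → (∀ i j → i < j → M i j ≈ 0#) → det′ n M ≈ Π< (λ i → M i i) n
  det′-lowerTriangular zero    M upper≈0 = refl
  det′-lowerTriangular (suc n) M upper≈0 = begin
    det′ (suc n) M                           ≈⟨ sumLt-single (laplaceTerm n M) (suc n) 0 (s≤s z≤n) others ⟩
    (1# * M 0 0) * det′ n (minor 0 M)        ≈⟨ *-cong (*-identityˡ _) (det′-lowerTriangular n (minor 0 M) minor-upper≈0) ⟩
    M 0 0 * Π< (λ i → M (suc i) (suc i)) n   ≈⟨ prodLt-shift (λ i → M i i) n ⟨
    Π< (λ i → M i i) (suc n)                 ∎
    where
    others : ∀ j → j < suc n → j ≢ 0 → laplaceTerm n M j ≈ 0#
    others zero    _ 0≢0 = contradiction ≡.refl 0≢0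
    others (suc j) _ _   = trans (*-congʳ (trans (*-congˡ (upper≈0 0 (suc j) (s≤s z≤n))) (zeroʳ _))) (zeroˡ _)
    minor-upper≈0 : ∀ i j → i < j → minor 0 M i j ≈ 0#
    minor-upper≈0 i j i<j = upper≈0 (suc i) (suc j) (s≤s i<j)

  sumFin-cong : ∀ n {f g : Fin n → Carrier} → (∀ i → f i ≈ g i) → sumFin R n f ≈ sumFin R n g
  sumFin-cong zero    f≈g = refl
  sumFin-cong (suc n) f≈g = +-cong (f≈g fzero) (sumFin-cong n (λ i → f≈g (fsuc i)))

  sumFin-toℕ : ∀ n (g : ℕ → Carrier) → sumFin R n (λ j → g (toℕ j)) ≈ Σ< g n
  sumFin-toℕ zero    g = refl
  sumFin-toℕ (suc n) g = trans (+-congˡ (sumFin-toℕ n (λ j → g (suc j)))) (sym (sumLt-shift g n))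

  det-cong : ∀ n {M N : Fin n → Fin n → Carrier} → (∀ i j → M i j ≈ N i j) → det R n M ≈ det R n N
  det-cong zero    M≈N = refl
  det-cong (suc n) M≈N = sumFin-cong (suc n) (λ j →
    *-cong (*-congˡ {(- 1#) ^ toℕ j} (M≈N fzero j)) (det-cong n (λ i k → M≈N (fsuc i) (punchIn j k))))

  toℕ-punchIn : ∀ {n} (j : Fin (suc n)) (k : Fin n) → toℕ (punchIn j k) ≡ punchInℕ (toℕ j) (toℕ k)
  toℕ-punchIn fzero    k        = ≡.refl
  toℕ-punchIn (fsuc j) fzero    = ≡.refl
  toℕ-punchIn (fsuc j) (fsuc k) = ≡.cong suc (toℕ-punchIn j k)

  pow-neg-one : ∀ k → (- 1#) ^ k ≈ alternating k
  pow-neg-one zero    = refl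
  pow-neg-one (suc k) = trans (*-congˡ (pow-neg-one k)) (solve 1 (λ s → (:- con (+ 1)) :* s := :- s) refl _)

  det≈det′ : ∀ n (A : Matrix) → det R n (λ i j → A (toℕ i) (toℕ j)) ≈ det′ n A
  det≈det′ zero    A = refl
  det≈det′ (suc n) A = trans (sumFin-cong (suc n) term) (sumFin-toℕ (suc n) (laplaceTerm n A))
    where
    term : ∀ j → ((- 1#) ^ toℕ j * A 0 (toℕ j)) * det R n (λ i k → A (suc (toℕ i)) (toℕ (punchIn j k)))
                 ≈ laplaceTerm n A (toℕ j)
    term j = *-cong (*-congʳ (pow-neg-one (toℕ j)))
      (trans (det-cong n (λ i k → reflexive (≡.cong (A (suc (toℕ i))) (toℕ-punchIn j k))))
             (det≈det′ n (minor (toℕ j) A)))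

module QBinomial {c ℓ : Level} (R : CommutativeRing c ℓ) (q : CommutativeRing.Carrier R) where
  open CommutativeRing R hiding (zero)
  open import Relation.Binary.Reasoning.Setoid setoid
  open IntegerSolver R using (solve; _:=_; _:+_; _:*_; _:-_; con)
  open Sums R

  [_choose_] : ℕ → ℕ → Carrier
  [ n choose k ] = qBinom R q n k

  qBinom-zero : ∀ n → [ n choose 0 ] ≈ 1#
  qBinom-zero zero    = refl
  qBinom-zero (suc n) = refl

  qBinom-> : ∀ n k → n < k → [ n choose k ] ≈ 0#
  qBinom-> zero    (suc k) _         = refl
  qBinom-> (suc n) (suc k) (s≤s n<k) =
    trans (+-cong (qBinom-> n k n<k) (*-congˡ (qBinom-> n (suc k) (ℕ.m<n⇒m<1+n n<k))))
          (solve 1 (λ a → con (+ 0) :+ a :* con (+ 0) := con (+ 0)) refl _)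

  qBinom-diag : ∀ n → [ n choose n ] ≈ 1#
  qBinom-diag zero    = refl
  qBinom-diag (suc n) = trans (+-cong (qBinom-diag n) (*-congˡ (qBinom-> n (suc n) ℕ.≤-refl)))
                              (solve 1 (λ a → con (+ 1) :+ a :* con (+ 0) := con (+ 1)) refl _)

  gauss : ℕ → ℕ → Carrier
  gauss a b = [ b ℕ.+ a choose b ]

  gauss-pascal : ∀ a b → gauss (suc a) (suc b) ≈ gauss (suc a) b + q ^ suc b * gauss a (suc b)
  gauss-pascal a b = +-congˡ (*-congˡ (reflexive (≡.cong [_choose suc b ] (ℕ.+-suc b a))))

  gauss-absorbˡ : ∀ a b → (1# - q ^ suc a) * gauss (suc a) b ≈ (1# - q ^ suc (a ℕ.+ b)) * gauss a b
  gauss-absorbʳ : ∀ a b → (1# - q ^ suc b) * gauss a (suc b) ≈ (1# - q ^ suc (a ℕ.+ b)) * gauss a b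

  gauss-absorbˡ a zero = begin
    (1# - q ^ suc a) * gauss (suc a) 0       ≈⟨ *-congˡ (qBinom-zero (suc a)) ⟩
    (1# - q ^ suc a) * 1#                    ≡⟨ ≡.cong (λ z → (1# - q ^ suc z) * 1#) (ℕ.+-identityʳ a) ⟨
    (1# - q ^ suc (a ℕ.+ 0)) * 1#            ≈⟨ *-congˡ (qBinom-zero a) ⟨
    (1# - q ^ suc (a ℕ.+ 0)) * gauss a 0     ∎
  gauss-absorbˡ a (suc b) = begin
    (1# - A) * gauss (suc a) (suc b)
      ≈⟨ *-congˡ (gauss-pascal a b) ⟩
    (1# - A) * (gauss (suc a) b + B * gauss a (suc b))
      ≈⟨ solve 4 (λ A B X Y → (con (+ 1) :- A) :* (X :+ B :* Y) := (con (+ 1) :- A) :* X :+ B :* ((con (+ 1) :- A) :* Y)) refl _ _ _ _ ⟩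
    (1# - A) * gauss (suc a) b + B * ((1# - A) * gauss a (suc b))
      ≈⟨ +-congʳ (trans (gauss-absorbˡ a b) (sym (gauss-absorbʳ a b))) ⟩
    (1# - B) * gauss a (suc b) + B * ((1# - A) * gauss a (suc b))
      ≈⟨ solve 3 (λ A B Y → (con (+ 1) :- B) :* Y :+ B :* ((con (+ 1) :- A) :* Y) := (con (+ 1) :- A :* B) :* Y) refl _ _ _ ⟩
    (1# - A * B) * gauss a (suc b)
      ≈⟨ *-congʳ (+-congˡ (-‿cong (sym (pow-homo-* q (suc a) (suc b))))) ⟩
    (1# - q ^ suc (a ℕ.+ suc b)) * gauss a (suc b) ∎
    where
    A = q ^ suc a
    B = q ^ suc b
  gauss-absorbʳ zero b = begin
    (1# - q ^ suc b) * gauss 0 (suc b)       ≈⟨ *-congˡ (gauss-zeroˡ (suc b)) ⟩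
    (1# - q ^ suc b) * 1#                    ≈⟨ *-congˡ (gauss-zeroˡ b) ⟨
    (1# - q ^ suc b) * gauss 0 b             ∎
    where
    gauss-zeroˡ : ∀ b → gauss 0 b ≈ 1#
    gauss-zeroˡ b = trans (reflexive (≡.cong [_choose b ] (ℕ.+-identityʳ b))) (qBinom-diag b)
  gauss-absorbʳ (suc a) b = begin
    (1# - B) * gauss (suc a) (suc b)
      ≈⟨ *-congˡ (gauss-pascal a b) ⟩
    (1# - B) * (gauss (suc a) b + B * gauss a (suc b))
      ≈⟨ solve 3 (λ B X Y → (con (+ 1) :- B) :* (X :+ B :* Y) := (con (+ 1) :- B) :* X :+ B :* ((con (+ 1) :- B) :* Y)) refl _ _ _ ⟩
    (1# - B) * gauss (suc a) b + B * ((1# - B) * gauss a (suc b))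
      ≈⟨ +-congˡ (*-congˡ (trans (gauss-absorbʳ a b) (sym (gauss-absorbˡ a b)))) ⟩
    (1# - B) * gauss (suc a) b + B * ((1# - A) * gauss (suc a) b)
      ≈⟨ solve 3 (λ A B X → (con (+ 1) :- B) :* X :+ B :* ((con (+ 1) :- A) :* X) := (con (+ 1) :- A :* B) :* X) refl _ _ _ ⟩
    (1# - A * B) * gauss (suc a) b
      ≈⟨ *-congʳ (+-congˡ (-‿cong (trans (sym (pow-homo-* q (suc a) (suc b))) (reflexive (≡.cong (λ z → q ^ suc z) (ℕ.+-suc a b)))))) ⟩
    (1# - q ^ suc (suc a ℕ.+ b)) * gauss (suc a) b ∎
    where
    A = q ^ suc a
    B = q ^ suc b

  gauss-exchange : ∀ a b → (1# - q ^ suc a) * gauss (suc a) b ≈ (1# - q ^ suc b) * gauss a (suc b)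
  gauss-exchange a b = trans (gauss-absorbˡ a b) (sym (gauss-absorbʳ a b))

  qBinom-pascal′ : ∀ i r → r ≤ i → [ suc i choose suc r ] ≈ q ^ (i ∸ r) * [ i choose r ] + [ i choose suc r ]
  qBinom-pascal′ i r r≤i =
    ≡.subst (λ z → [ suc z choose suc r ] ≈ q ^ (z ∸ r) * [ z choose r ] + [ z choose suc r ])
            (ℕ.m+[n∸m]≡n r≤i)
            (trans (pascal′ r (i ∸ r)) (+-congʳ (*-congʳ (reflexive (≡.cong (q ^_) (≡.sym (ℕ.m+n∸m≡n r (i ∸ r))))))))
    where
    pascal′ : ∀ r s → [ suc (r ℕ.+ s) choose suc r ] ≈ q ^ s * [ r ℕ.+ s choose r ] + [ r ℕ.+ s choose suc r ]
    pascal′ r zero = begin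
      X + q ^ suc r * Y       ≈⟨ +-congˡ (*-congˡ Y≈0) ⟩
      X + q ^ suc r * 0#      ≈⟨ solve 2 (λ X B → X :+ B :* con (+ 0) := con (+ 1) :* X :+ con (+ 0)) refl _ _ ⟩
      1# * X + 0#             ≈⟨ +-congˡ Y≈0 ⟨
      1# * X + Y              ∎
      where
      X = [ r ℕ.+ 0 choose r ]
      Y = [ r ℕ.+ 0 choose suc r ]
      Y≈0 = qBinom-> (r ℕ.+ 0) (suc r) (s≤s (ℕ.≤-reflexive (ℕ.+-identityʳ r)))
    pascal′ r (suc s) = begin
      X + B * Y                          ≈⟨ solve 4 (λ X Y B Q → X :+ B :* Y := Q :* X :+ ((con (+ 1) :- Q) :* X :+ B :* Y)) refl _ _ _ _ ⟩
      Q * X + ((1# - Q) * X + B * Y)     ≈⟨ +-congˡ (+-congʳ (trans (gauss-exchange s r) (*-congˡ (reflexive (≡.cong [_choose suc r ] (≡.sym (ℕ.+-suc r s))))))) ⟩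
      Q * X + ((1# - B) * Y + B * Y)     ≈⟨ solve 4 (λ X Y B Q → Q :* X :+ ((con (+ 1) :- B) :* Y :+ B :* Y) := Q :* X :+ Y) refl _ _ _ _ ⟩
      Q * X + Y                          ∎
      where
      X = [ r ℕ.+ suc s choose r ]
      Y = [ r ℕ.+ suc s choose suc r ]
      B = q ^ suc r
      Q = q ^ suc s

  qPoch-cong : ∀ {A B} k → A ≈ B → qPoch R A q k ≈ qPoch R B q k
  qPoch-cong k A≈B = prodLt-cong k (λ i _ → +-congˡ (-‿cong (*-congʳ A≈B)))

  qPoch-shift : ∀ A k → qPoch R A q (suc k) ≈ (1# - A) * qPoch R (A * q) q k
  qPoch-shift A k = trans (prodLt-shift _ k)
    (*-cong (+-congˡ (-‿cong (*-identityʳ A))) (prodLt-cong k (λ i _ → +-congˡ (-‿cong (sym (*-assoc A q (q ^ i)))))))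

-- coeff j m is the coefficient of p_m in Q_j; it does not depend on x, which is therefore
-- a parameter of the recurrence only.
module OrthogonalPolynomials {c ℓ : Level} (R : CommutativeRing c ℓ) (q u v : CommutativeRing.Carrier R) where
  open CommutativeRing R hiding (zero)
  open import Relation.Binary.Reasoning.Setoid setoid
  open IntegerSolver R using (solve; _:=_; _:+_; _:*_; :-_; _:-_; con; Polynomial)
  open Sums R
  open QBinomial R q

  poch : Carrier → ℕ → Carrier
  poch A k = qPoch R A q k

  ω : ℕ → Carrier
  ω zero    = 1#
  ω (suc k) = (- v * q ^ k) * ω k

  coeff⁺ : ℕ → ℕ → Carrier
  coeff⁺ m k = (ω k * [ m ℕ.+ k choose m ]) * poch (u * q ^ m) k

  coeff : ℕ → ℕ → Carrier
  coeff j m with m ℕ.≤? j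
  ... | yes _ = coeff⁺ m (j ∸ m)
  ... | no  _ = 0#

  coeff-+ : ∀ m k → coeff (m ℕ.+ k) m ≈ coeff⁺ m k
  coeff-+ m k with m ℕ.≤? m ℕ.+ k
  ... | yes _   = reflexive (≡.cong (coeff⁺ m) (ℕ.m+n∸m≡n m k))
  ... | no  m≰j = contradiction (ℕ.m≤m+n m k) m≰j

  coeff-≡ : ∀ j m k → j ≡ m ℕ.+ k → coeff j m ≈ coeff⁺ m k
  coeff-≡ j m k ≡.refl = coeff-+ m k

  coeff-> : ∀ j m → j < m → coeff j m ≈ 0#
  coeff-> j m j<m with m ℕ.≤? j
  ... | yes m≤j = contradiction m≤j (ℕ.<⇒≱ j<m)
  ... | no  _   = refl

  coeff⁺-zero : ∀ m → coeff⁺ m 0 ≈ 1#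
  coeff⁺-zero m = trans (*-identityʳ _) (trans (*-identityˡ _)
    (trans (reflexive (≡.cong [_choose m ] (ℕ.+-identityʳ m))) (qBinom-diag m)))

  coeff-diag : ∀ j → coeff j j ≈ 1#
  coeff-diag j = trans (coeff-≡ j j 0 (≡.sym (ℕ.+-identityʳ j))) (coeff⁺-zero j)

  -- Recurrence coefficients: b j = q^j x + b₀ j and β j = κ (q^j) (uv q^j − x);
  -- b₀ (1+j) = η (q^j), and θ T = uvT κ T is the x-free part of β.
  κ : Carrier → Carrier
  κ T = ((v * T) * (1# - u * T)) * (1# - q * T)

  η : Carrier → Carrier
  η T = (v * (q * T)) * (1# - u * (q * T)) + ((u * v) * T) * (1# - q * T)

  θ : Carrier → Carrier
  θ T = ((u * v) * T) * κ T

  b₀ : ℕ → Carrier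
  b₀ zero    = v * (1# - u)
  b₀ (suc j) = η (q ^ j)

  κ-cong : ∀ {S T} → S ≈ T → κ S ≈ κ T
  κ-cong S≈T = *-cong (*-cong (*-congˡ S≈T) (+-congˡ (-‿cong (*-congˡ S≈T)))) (+-congˡ (-‿cong (*-congˡ S≈T)))

  η-cong : ∀ {S T} → S ≈ T → η S ≈ η T
  η-cong S≈T = +-cong (*-cong (*-congˡ (*-congˡ S≈T)) (+-congˡ (-‿cong (*-congˡ (*-congˡ S≈T)))))
                      (*-cong (*-congˡ S≈T) (+-congˡ (-‿cong (*-congˡ S≈T))))

  θ-cong : ∀ {S T} → S ≈ T → θ S ≈ θ T
  θ-cong S≈T = *-cong (*-congˡ S≈T) (κ-cong S≈T)

  -- Each identity below holds only modulo a relation ρ between q-binomials; the solver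
  -- checks it with an explicit multiple of ρ added.
  modulo : ∀ {L Rt K a b} → L ≈ Rt + K * (a - b) → a ≈ b → L ≈ Rt
  modulo {Rt = Rt} {K} {b = b} eq a≈b = trans eq (trans (+-congˡ (*-congˡ (+-congʳ a≈b)))
    (solve 3 (λ Rt K b → Rt :+ K :* (b :- b) := Rt) refl Rt K b))

  modulo₂ : ∀ {L Rt K₁ a₁ b₁ K₂ a₂ b₂} → L ≈ Rt + (K₁ * (a₁ - b₁) + K₂ * (a₂ - b₂)) → a₁ ≈ b₁ → a₂ ≈ b₂ → L ≈ Rt
  modulo₂ {Rt = Rt} {K₁} {b₁ = b₁} {K₂} {b₂ = b₂} eq a₁≈b₁ a₂≈b₂ =
    trans eq (trans (+-congˡ (+-cong (*-congˡ (+-congʳ a₁≈b₁)) (*-congˡ (+-congʳ a₂≈b₂))))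
      (solve 5 (λ Rt K₁ b₁ K₂ b₂ → Rt :+ (K₁ :* (b₁ :- b₁) :+ K₂ :* (b₂ :- b₂)) := Rt) refl Rt K₁ b₁ K₂ b₂))

  coeff⁺-x-part : ∀ m k → q ^ m * coeff⁺ m (suc k) ≈ q ^ suc (m ℕ.+ k) * coeff⁺ m (suc k) - κ (q ^ (m ℕ.+ k)) * coeff⁺ m k
  coeff⁺-x-part m k = begin
    M * ((((- v * Q) * ωₖ) * Bb) * (Pk * (1# - (u * M) * Q)))
      ≈⟨ modulo {K = ((((- v) * Q) * M) * (ωₖ * Pk)) * (1# - (u * M) * Q)}
           (solve 9 (λ M Q q v u ωₖ Pk Bb Bc →
               M :* ((((:- v :* Q) :* ωₖ) :* Bb) :* (Pk :* (con (+ 1) :- (u :* M) :* Q)))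
            := (q :* (M :* Q)) :* ((((:- v :* Q) :* ωₖ) :* Bb) :* (Pk :* (con (+ 1) :- (u :* M) :* Q)))
               :- (((v :* (M :* Q)) :* (con (+ 1) :- u :* (M :* Q))) :* (con (+ 1) :- q :* (M :* Q))) :* ((ωₖ :* Bc) :* Pk)
               :+ ((((:- v) :* Q) :* M) :* (ωₖ :* Pk)) :* (con (+ 1) :- (u :* M) :* Q)
                  :* ((con (+ 1) :- q :* Q) :* Bb :- (con (+ 1) :- q :* (M :* Q)) :* Bc))
            refl M Q q v u ωₖ Pk Bb Bc)
           ρ ⟩
    (q * (M * Q)) * ((((- v * Q) * ωₖ) * Bb) * (Pk * (1# - (u * M) * Q))) - κ (M * Q) * ((ωₖ * Bc) * Pk)
      ≈⟨ +-cong (*-congʳ (*-congˡ (sym (pow-homo-* q m k)))) (-‿cong (*-congʳ (κ-cong (sym (pow-homo-* q m k))))) ⟩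
    q ^ suc (m ℕ.+ k) * coeff⁺ m (suc k) - κ (q ^ (m ℕ.+ k)) * coeff⁺ m k ∎
    where
    M = q ^ m
    Q = q ^ k
    ωₖ = ω k
    Pk = poch (u * M) k
    Bb = [ m ℕ.+ suc k choose m ]
    Bc = [ m ℕ.+ k choose m ]
    ρ : (1# - q * Q) * Bb ≈ (1# - q * (M * Q)) * Bc
    ρ = trans (gauss-absorbˡ k m)
              (*-congʳ (+-congˡ (-‿cong (*-congˡ (trans (reflexive (≡.cong (q ^_) (ℕ.+-comm k m))) (pow-homo-* q m k))))))

  private
    κₑ ηₑ θₑ : ∀ {n} → Polynomial n → Polynomial n → Polynomial n → Polynomial n → Polynomial n
    κₑ v u q T = ((v :* T) :* (con (+ 1) :- u :* T)) :* (con (+ 1) :- q :* T)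
    ηₑ v u q T = (v :* (q :* T)) :* (con (+ 1) :- u :* (q :* T)) :+ ((u :* v) :* T) :* (con (+ 1) :- q :* T)
    θₑ v u q T = ((u :* v) :* T) :* κₑ v u q T
    one zer : ∀ {n} → Polynomial n
    one = con (+ 1)
    zer = con (+ 0)

  coeff⁺-recurrence-00 : 0# ≈ coeff⁺ 0 1 + b₀ 0 * coeff⁺ 0 0 + 0#
  coeff⁺-recurrence-00 = solve 2 (λ u v →
    zer := ((((:- v :* one) :* one) :* one) :* (one :* (one :- (u :* one) :* one))) :+ (v :* (one :- u)) :* ((one :* one) :* one) :+ zer)
    refl u v

  coeff⁺-recurrence-0k : ∀ k → 0# ≈ coeff⁺ 0 (suc (suc k)) + η (q ^ k) * coeff⁺ 0 (suc k) + θ (q ^ k) * coeff⁺ 0 k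
  coeff⁺-recurrence-0k k = begin
    0#
      ≈⟨ solve 6 (λ u v q Q ωₖ Pk →
           zer := (((:- v :* (q :* Q)) :* ((:- v :* Q) :* ωₖ)) :* one) :* ((Pk :* (one :- (u :* one) :* Q)) :* (one :- (u :* one) :* (q :* Q)))
             :+ ηₑ v u q Q :* ((((:- v :* Q) :* ωₖ) :* one) :* (Pk :* (one :- (u :* one) :* Q)))
             :+ θₑ v u q Q :* ((ωₖ :* one) :* Pk))
           refl u v q (q ^ k) (ω k) (poch (u * 1#) k) ⟩
    _ ≈⟨ +-congˡ (*-congˡ (*-congʳ (*-congˡ (sym (qBinom-zero k))))) ⟩
    coeff⁺ 0 (suc (suc k)) + η (q ^ k) * coeff⁺ 0 (suc k) + θ (q ^ k) * coeff⁺ 0 k ∎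

  coeff⁺-recurrence-m0 : ∀ m → coeff⁺ m 1 ≈ coeff⁺ (suc m) 1 + η (q ^ m) * coeff⁺ (suc m) 0
  coeff⁺-recurrence-m0 m = begin
    coeff⁺ m 1
      ≈⟨ modulo {K = (u * v) * S}
           (solve 5 (λ u v q S Y →
              ((((:- v :* one) :* one) :* Y) :* (one :* (one :- (u :* S) :* one)))
              := ((((:- v :* one) :* one) :* (Y :+ (q :* S) :* one)) :* (one :* (one :- (u :* (q :* S)) :* one)))
                 :+ ηₑ v u q S :* one
                 :+ ((u :* v) :* S) :* ((one :- q :* one) :* Y :- (one :- q :* S) :* one))
            refl u v q S Y)
           ρ ⟩
    ((((- v * 1#) * 1#) * (Y + (q * S) * 1#)) * (1# * (1# - (u * (q * S)) * 1#))) + η S * 1#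
      ≈⟨ +-cong (*-congʳ (*-congˡ (+-congˡ (*-congˡ (sym Z≈1))))) (*-congˡ (sym (coeff⁺-zero (suc m)))) ⟩
    coeff⁺ (suc m) 1 + η (q ^ m) * coeff⁺ (suc m) 0 ∎
    where
    S = q ^ m
    Y = [ m ℕ.+ 1 choose m ]
    Z≈1 : [ m ℕ.+ 1 choose suc m ] ≈ 1#
    Z≈1 = trans (reflexive (≡.cong [_choose suc m ] (ℕ.+-comm m 1))) (qBinom-diag (suc m))
    ρ : (1# - q * 1#) * Y ≈ (1# - q * S) * 1#
    ρ = trans (gauss-absorbˡ 0 m) (*-congˡ (trans (reflexive (≡.cong [_choose m ] (ℕ.+-identityʳ m))) (qBinom-diag m)))

  coeff⁺-recurrence-mk : ∀ m k → coeff⁺ m (suc (suc k)) ≈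
    coeff⁺ (suc m) (suc (suc k)) + η (q ^ (m ℕ.+ suc k)) * coeff⁺ (suc m) (suc k) + θ (q ^ (m ℕ.+ suc k)) * coeff⁺ (suc m) k
  coeff⁺-recurrence-mk m k = begin
    ((ω₂ * B₁) * poch (u * S) (suc (suc k)))
      ≈⟨ *-congˡ poch-peel ⟩
    ((ω₂ * B₁) * ((1# - u * S) * (Pk * (1# - (u * (q * S)) * Q))))
      ≈⟨ modulo₂ {K₁ = (ωₖ * Pk) * l₁} {K₂ = (ωₖ * Pk) * l₂}
           (solve 10 (λ u v q S Q ωₖ Pk b₁ b₃ b₄ →
              ((((:- v :* (q :* Q)) :* ((:- v :* Q) :* ωₖ)) :* b₁) :* ((one :- u :* S) :* (Pk :* (one :- (u :* (q :* S)) :* Q))))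
              := (((:- v :* (q :* Q)) :* ((:- v :* Q) :* ωₖ)) :* (b₁ :+ (q :* S) :* b₃)) :* ((Pk :* (one :- (u :* (q :* S)) :* Q)) :* (one :- (u :* (q :* S)) :* (q :* Q)))
                 :+ ηₑ v u q (S :* (q :* Q)) :* ((((:- v :* Q) :* ωₖ) :* b₃) :* (Pk :* (one :- (u :* (q :* S)) :* Q)))
                 :+ θₑ v u q (S :* (q :* Q)) :* ((ωₖ :* b₄) :* Pk)
                 :+ ((ωₖ :* Pk) :* ((q :* q) :* ((u :* u) :* ((v :* v) :* ((S :* S) :* (Q :* (Q :* Q))))) :- q :* (u :* ((v :* v) :* (S :* (Q :* Q)))))
                       :* ((one :- q :* (q :* Q)) :* b₁ :- (one :- q :* S) :* b₃)
                    :+ (ωₖ :* Pk) :* ((q :* q) :* (u :* ((v :* v) :* ((S :* S) :* (Q :* Q)))) :- (q :* (q :* q)) :* ((u :* u) :* ((v :* v) :* ((S :* (S :* S)) :* (Q :* (Q :* Q))))))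
                       :* ((one :- q :* Q) :* b₃ :- (one :- q :* (S :* (q :* Q))) :* b₄)))
            refl u v q S Q ωₖ Pk B₁ B₃ B₄)
           ρ₁ ρ₂ ⟩
    (ω₂ * (B₁ + (q * S) * B₃)) * ((Pk * (1# - (u * (q * S)) * Q)) * (1# - (u * (q * S)) * (q * Q)))
      + η (S * (q * Q)) * ((((- v * Q) * ωₖ) * B₃) * (Pk * (1# - (u * (q * S)) * Q)))
      + θ (S * (q * Q)) * ((ωₖ * B₄) * Pk)
      ≈⟨ +-cong (+-cong (*-congʳ (*-congˡ (+-congˡ (*-congˡ (sym B₃≡))))) (*-congʳ (η-cong (sym T≈)))) (*-congʳ (θ-cong (sym T≈))) ⟩
    coeff⁺ (suc m) (suc (suc k)) + η (q ^ (m ℕ.+ suc k)) * coeff⁺ (suc m) (suc k) + θ (q ^ (m ℕ.+ suc k)) * coeff⁺ (suc m) k ∎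
    where
    S = q ^ m
    Q = q ^ k
    ωₖ = ω k
    ω₂ = ω (suc (suc k))
    Pk = poch (u * (q * S)) k
    B₁ = [ m ℕ.+ suc (suc k) choose m ]
    B₃ = [ suc m ℕ.+ suc k choose suc m ]
    B₄ = [ suc m ℕ.+ k choose suc m ]
    l₁ = (q * q) * ((u * u) * ((v * v) * ((S * S) * (Q * (Q * Q))))) - q * (u * ((v * v) * (S * (Q * Q))))
    l₂ = (q * q) * (u * ((v * v) * ((S * S) * (Q * Q)))) - (q * (q * q)) * ((u * u) * ((v * v) * ((S * (S * S)) * (Q * (Q * Q)))))
    T≈ : q ^ (m ℕ.+ suc k) ≈ S * (q * Q)
    T≈ = pow-homo-* q m (suc k)
    B₃≡ : [ m ℕ.+ suc (suc k) choose suc m ] ≈ B₃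
    B₃≡ = reflexive (≡.cong [_choose suc m ] (ℕ.+-suc m (suc k)))
    poch-peel : poch (u * S) (suc (suc k)) ≈ (1# - u * S) * (Pk * (1# - (u * (q * S)) * Q))
    poch-peel = trans (qPoch-shift (u * S) (suc k)) (*-congˡ (qPoch-cong (suc k) (trans (*-assoc u S q) (*-congˡ (*-comm S q)))))
    ρ₁ : (1# - q * (q * Q)) * B₁ ≈ (1# - q * S) * B₃
    ρ₁ = gauss-exchange (suc k) m
    ρ₂ : (1# - q * Q) * B₃ ≈ (1# - q * (S * (q * Q))) * B₄
    ρ₂ = trans (gauss-absorbˡ k (suc m)) (*-congʳ (+-congˡ (-‿cong (*-congˡ (trans (reflexive (≡.cong (q ^_)
           (≡.trans (ℕ.+-suc k m) (≡.trans (≡.cong suc (ℕ.+-comm k m)) (≡.sym (ℕ.+-suc m k)))))) T≈)))))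

  shiftʳ : (ℕ → Carrier) → ℕ → Carrier
  shiftʳ f zero    = 0#
  shiftʳ f (suc n) = f n

  -- lowerTerm f j m is the coefficient of p_m in f (j − 1) · Q_{j−1}.
  lowerTerm : (ℕ → Carrier) → ℕ → ℕ → Carrier
  lowerTerm f j m = shiftʳ (λ i → f i * coeff i m) j

  lowerTerm-≥ : ∀ f j m → j ≤ m → lowerTerm f j m ≈ 0#
  lowerTerm-≥ f zero    m _         = refl
  lowerTerm-≥ f (suc j) m 1+j≤m = trans (*-congˡ (coeff-> j m 1+j≤m)) (zeroʳ _)

  data Position (j m : ℕ) : Set where
    beyond : suc j < m → Position j m
    next   : m ≡ suc j → Position j m
    within : ∀ k → j ≡ m ℕ.+ k → Position j m

  position : ∀ j m → Position j m
  position j m with ℕ.<-cmp j m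
  ... | tri< j<m _ _ with ℕ.m≤n⇒m<n∨m≡n j<m
  ...   | inj₁ 1+j<m = beyond 1+j<m
  ...   | inj₂ 1+j≡m = next (≡.sym 1+j≡m)
  position j m | tri≈ _ j≡m _ = within 0 (≡.trans j≡m (≡.sym (ℕ.+-identityʳ m)))
  position j m | tri> _ _ m<j = within (j ∸ m) (≡.sym (ℕ.m+[n∸m]≡n (ℕ.<⇒≤ m<j)))

  recurrence-x-< : ∀ j m → j < m → q ^ m * coeff j m ≈ q ^ j * coeff j m - lowerTerm (λ i → κ (q ^ i)) j m
  recurrence-x-< j m j<m = begin
    q ^ m * coeff j m         ≈⟨ *-congˡ (coeff-> j m j<m) ⟩
    q ^ m * 0#                ≈⟨ solve 2 (λ a b → a :* zer := b :* zer :- zer) refl _ _ ⟩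
    q ^ j * 0# - 0#           ≈⟨ +-cong (*-congˡ (coeff-> j m j<m)) (-‿cong (lowerTerm-≥ _ j m (ℕ.<⇒≤ j<m))) ⟨
    q ^ j * coeff j m - lowerTerm (λ i → κ (q ^ i)) j m ∎

  recurrence-x : ∀ j m → q ^ m * coeff j m ≈ q ^ j * coeff j m - lowerTerm (λ i → κ (q ^ i)) j m
  recurrence-x j m with position j m
  ... | beyond 1+j<m = recurrence-x-< j m (ℕ.<-trans (ℕ.n<1+n j) 1+j<m)
  ... | next ≡.refl  = recurrence-x-< j m (ℕ.n<1+n j)
  ... | within zero ≡.refl rewrite ℕ.+-identityʳ m =
    trans (solve 2 (λ a b → a :* b := a :* b :- zer) refl _ _) (+-congˡ (-‿cong (sym (lowerTerm-≥ _ m m ℕ.≤-refl))))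
  ... | within (suc k) ≡.refl rewrite ℕ.+-suc m k = begin
    q ^ m * coeff (suc (m ℕ.+ k)) m
      ≈⟨ *-congˡ top ⟩
    q ^ m * coeff⁺ m (suc k)
      ≈⟨ coeff⁺-x-part m k ⟩
    q ^ suc (m ℕ.+ k) * coeff⁺ m (suc k) - κ (q ^ (m ℕ.+ k)) * coeff⁺ m k
      ≈⟨ +-cong (*-congˡ (sym top)) (-‿cong (*-congˡ (sym (coeff-+ m k)))) ⟩
    q ^ suc (m ℕ.+ k) * coeff (suc (m ℕ.+ k)) m - κ (q ^ (m ℕ.+ k)) * coeff (m ℕ.+ k) m ∎
    where
    top : coeff (suc (m ℕ.+ k)) m ≈ coeff⁺ m (suc k)
    top = coeff-≡ (suc (m ℕ.+ k)) m (suc k) (≡.sym (ℕ.+-suc m k))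

  recurrence₀ : ∀ j m → shiftʳ (coeff j) m ≈ coeff (suc j) m + b₀ j * coeff j m + lowerTerm (λ i → θ (q ^ i)) j m
  recurrence₀ j m with position j m
  ... | beyond 1+j<m = begin
    shiftʳ (coeff j) m      ≈⟨ shifted-zero m 1+j<m ⟩
    0#                      ≈⟨ solve 1 (λ b → zer := zer :+ b :* zer :+ zer) refl _ ⟩
    0# + b₀ j * 0# + 0#     ≈⟨ +-cong (+-cong (coeff-> (suc j) m 1+j<m) (*-congˡ (coeff-> j m j<m))) (lowerTerm-≥ _ j m (ℕ.<⇒≤ j<m)) ⟨
    coeff (suc j) m + b₀ j * coeff j m + lowerTerm (λ i → θ (q ^ i)) j m ∎
    where
    j<m = ℕ.<-trans (ℕ.n<1+n j) 1+j<m
    shifted-zero : ∀ m → suc j < m → shiftʳ (coeff j) m ≈ 0#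
    shifted-zero (suc m) (s≤s j<m) = coeff-> j m j<m
  ... | next ≡.refl = begin
    coeff j j               ≈⟨ coeff-diag j ⟩
    1#                      ≈⟨ solve 1 (λ b → one := one :+ b :* zer :+ zer) refl _ ⟩
    1# + b₀ j * 0# + 0#     ≈⟨ +-cong (+-cong (coeff-diag (suc j)) (*-congˡ (coeff-> j (suc j) (ℕ.n<1+n j)))) (lowerTerm-≥ _ j (suc j) (ℕ.n≤1+n j)) ⟨
    coeff (suc j) (suc j) + b₀ j * coeff j (suc j) + lowerTerm (λ i → θ (q ^ i)) j (suc j) ∎
  ... | within k ≡.refl = within-case m k
    where
    within-case : ∀ m k → shiftʳ (coeff (m ℕ.+ k)) m ≈
      coeff (suc (m ℕ.+ k)) m + b₀ (m ℕ.+ k) * coeff (m ℕ.+ k) m + lowerTerm (λ i → θ (q ^ i)) (m ℕ.+ k) m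
    within-case zero zero = trans coeff⁺-recurrence-00
      (sym (+-congʳ (+-cong (coeff-+ 0 1) (*-congˡ (coeff-+ 0 0)))))
    within-case zero (suc k) = trans (coeff⁺-recurrence-0k k)
      (sym (+-cong (+-cong (coeff-+ 0 (suc (suc k))) (*-congˡ (coeff-+ 0 (suc k)))) (*-congˡ (coeff-+ 0 k))))
    within-case (suc m) zero rewrite ℕ.+-identityʳ m = begin
      coeff (suc m) m
        ≈⟨ coeff-≡ (suc m) m 1 (ℕ.+-comm 1 m) ⟩
      coeff⁺ m 1
        ≈⟨ coeff⁺-recurrence-m0 m ⟩
      coeff⁺ (suc m) 1 + η (q ^ m) * coeff⁺ (suc m) 0
        ≈⟨ +-identityʳ _ ⟨
      coeff⁺ (suc m) 1 + η (q ^ m) * coeff⁺ (suc m) 0 + 0#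
        ≈⟨ +-cong (+-cong (coeff-≡ (suc (suc m)) (suc m) 1 (≡.cong suc (ℕ.+-comm 1 m)))
                          (*-congˡ (coeff-≡ (suc m) (suc m) 0 (≡.cong suc (≡.sym (ℕ.+-identityʳ m))))))
                  (lowerTerm-≥ (λ i → θ (q ^ i)) (suc m) (suc m) ℕ.≤-refl) ⟨
      coeff (suc (suc m)) (suc m) + b₀ (suc m) * coeff (suc m) (suc m) + lowerTerm (λ i → θ (q ^ i)) (suc m) (suc m) ∎
    within-case (suc m) (suc k) = begin
      coeff (suc (m ℕ.+ suc k)) m
        ≈⟨ coeff-≡ _ m (suc (suc k)) (≡.sym (ℕ.+-suc m (suc k))) ⟩
      coeff⁺ m (suc (suc k))
        ≈⟨ coeff⁺-recurrence-mk m k ⟩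
      coeff⁺ (suc m) (suc (suc k)) + η (q ^ (m ℕ.+ suc k)) * coeff⁺ (suc m) (suc k) + θ (q ^ (m ℕ.+ suc k)) * coeff⁺ (suc m) k
        ≈⟨ +-cong (+-cong (coeff-≡ _ (suc m) (suc (suc k)) (≡.cong suc (≡.sym (ℕ.+-suc m (suc k)))))
                          (*-congˡ (coeff-+ (suc m) (suc k))))
                  (*-congˡ (coeff-≡ _ (suc m) k (ℕ.+-suc m k))) ⟨
      coeff (suc (suc (m ℕ.+ suc k))) (suc m) + b₀ (suc (m ℕ.+ suc k)) * coeff (suc (m ℕ.+ suc k)) (suc m)
        + lowerTerm (λ i → θ (q ^ i)) (suc (m ℕ.+ suc k)) (suc m) ∎

  module _ (x : Carrier) where

    b : ℕ → Carrier
    b j = q ^ j * x + b₀ j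

    β : ℕ → Carrier
    β j = κ (q ^ j) * ((u * v) * q ^ j - x)

    recurrence : ∀ j m → shiftʳ (coeff j) m + (q ^ m * x) * coeff j m ≈ coeff (suc j) m + b j * coeff j m + lowerTerm β j m
    recurrence j m = begin
      shiftʳ (coeff j) m + (q ^ m * x) * coeff j m
        ≈⟨ +-cong (recurrence₀ j m) (trans (*-congʳ (*-comm _ _)) (trans (*-assoc _ _ _) (*-congˡ (recurrence-x j m)))) ⟩
      (coeff (suc j) m + b₀ j * coeff j m + lowerTerm (λ i → θ (q ^ i)) j m)
        + x * (q ^ j * coeff j m - lowerTerm (λ i → κ (q ^ i)) j m)
        ≈⟨ combine j ⟩
      coeff (suc j) m + b j * coeff j m + lowerTerm β j m ∎
      where
      combine : ∀ j → (coeff (suc j) m + b₀ j * coeff j m + lowerTerm (λ i → θ (q ^ i)) j m)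
                      + x * (q ^ j * coeff j m - lowerTerm (λ i → κ (q ^ i)) j m)
                      ≈ coeff (suc j) m + b j * coeff j m + lowerTerm β j m
      combine zero = solve 5 (λ c₁ b₀ c x Q → (c₁ :+ b₀ :* c :+ zer) :+ x :* (Q :* c :- zer) := c₁ :+ (Q :* x :+ b₀) :* c :+ zer)
                           refl _ _ _ _ _
      combine (suc j) = solve 10 (λ c₁ b₀ c x Q u v T K c′ →
          (c₁ :+ b₀ :* c :+ (((u :* v) :* T) :* K) :* c′) :+ x :* (Q :* c :- K :* c′)
          := c₁ :+ (Q :* x :+ b₀) :* c :+ (K :* ((u :* v) :* T :- x)) :* c′) refl _ _ _ _ _ _ _ _ _ _

  -- pair w j = L(Q_j) for the functional L with L(p_m) = w m.
  pair : (ℕ → Carrier) → ℕ → Carrier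
  pair w j = Σ< (λ m → coeff j m * w m) (suc j)

  pair-extend : ∀ w j {n} → suc j ≤ n → Σ< (λ m → coeff j m * w m) n ≈ pair w j
  pair-extend w j 1+j≤n = sumLt-extend _ 1+j≤n (λ m j<m → trans (*-congʳ (coeff-> j m j<m)) (zeroˡ _))

  sumLt-lowerTerm : ∀ f w j {n} → j ≤ n → Σ< (λ m → lowerTerm f j m * w m) n ≈ shiftʳ (λ i → f i * pair w i) j
  sumLt-lowerTerm f w zero    {n} _     = sumLt-zero _ n (λ _ _ → zeroˡ _)
  sumLt-lowerTerm f w (suc j) {n} 1+j≤n = trans (sumLt-cong n (λ m _ → *-assoc _ _ _))
    (trans (sym (*-distribˡ-sumLt _ _ n)) (*-congˡ (pair-extend w j 1+j≤n)))

  module _ (x : Carrier) where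

    pair-recurrence : ∀ (w w′ : ℕ → Carrier) → (∀ m → w′ m ≈ w (suc m) + (q ^ m * x) * w m) → ∀ j →
                      pair w′ j ≈ pair w (suc j) + b x j * pair w j + shiftʳ (λ i → β x i * pair w i) j
    pair-recurrence w w′ w′≈ j = begin
      Σ< (λ m → coeff j m * w′ m) (suc j)
        ≈⟨ sumLt-cong (suc j) (λ m _ → trans (*-congˡ (w′≈ m)) (distribˡ _ _ _)) ⟩
      Σ< (λ m → coeff j m * w (suc m) + coeff j m * ((q ^ m * x) * w m)) (suc j)
        ≈⟨ sumLt-distrib-+ _ _ (suc j) ⟩
      Σ< (λ m → coeff j m * w (suc m)) (suc j) + Σ< (λ m → coeff j m * ((q ^ m * x) * w m)) (suc j)
        ≈⟨ +-cong (sym (trans (sumLt-shift _ (suc j)) (trans (+-congʳ (zeroˡ _)) (+-identityˡ _))))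
                  (sym (sumLt-extend _ (ℕ.n≤1+n _) (λ m j<m → trans (*-congʳ (coeff-> j m j<m)) (zeroˡ _)))) ⟩
      Σ< (λ m → shiftʳ (coeff j) m * w m) (suc (suc j)) + Σ< (λ m → coeff j m * ((q ^ m * x) * w m)) (suc (suc j))
        ≈⟨ sumLt-distrib-+ _ _ (suc (suc j)) ⟨
      Σ< (λ m → shiftʳ (coeff j) m * w m + coeff j m * ((q ^ m * x) * w m)) (suc (suc j))
        ≈⟨ sumLt-cong (suc (suc j)) (λ m _ → trans (regroup m) (*-congʳ (recurrence x j m))) ⟩
      Σ< (λ m → (coeff (suc j) m + b x j * coeff j m + lowerTerm (β x) j m) * w m) (suc (suc j))
        ≈⟨ sumLt-cong (suc (suc j)) (λ m _ → distribute m) ⟩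
      Σ< (λ m → coeff (suc j) m * w m + b x j * (coeff j m * w m) + lowerTerm (β x) j m * w m) (suc (suc j))
        ≈⟨ trans (sumLt-distrib-+ _ _ (suc (suc j))) (+-congʳ (sumLt-distrib-+ _ _ (suc (suc j)))) ⟩
      pair w (suc j) + Σ< (λ m → b x j * (coeff j m * w m)) (suc (suc j)) + Σ< (λ m → lowerTerm (β x) j m * w m) (suc (suc j))
        ≈⟨ +-cong (+-congˡ (trans (sym (*-distribˡ-sumLt _ _ (suc (suc j)))) (*-congˡ (pair-extend w j (ℕ.n≤1+n _)))))
                  (sumLt-lowerTerm (β x) w j (ℕ.m≤n⇒m≤1+n (ℕ.n≤1+n j))) ⟩
      pair w (suc j) + b x j * pair w j + shiftʳ (λ i → β x i * pair w i) j ∎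
      where
      regroup : ∀ m → shiftʳ (coeff j) m * w m + coeff j m * ((q ^ m * x) * w m)
                      ≈ (shiftʳ (coeff j) m + (q ^ m * x) * coeff j m) * w m
      regroup m = solve 4 (λ s c y w → s :* w :+ c :* (y :* w) := (s :+ y :* c) :* w) refl _ _ _ _
      distribute : ∀ m → (coeff (suc j) m + b x j * coeff j m + lowerTerm (β x) j m) * w m
                         ≈ coeff (suc j) m * w m + b x j * (coeff j m * w m) + lowerTerm (β x) j m * w m
      distribute m = solve 5 (λ c₁ b c l w → (c₁ :+ b :* c :+ l) :* w := c₁ :* w :+ b :* (c :* w) :+ l :* w) refl _ _ _ _ _

  pair-cong : ∀ {w w′} j → (∀ m → w m ≈ w′ m) → pair w j ≈ pair w′ j
  pair-cong j w≈w′ = sumLt-cong (suc j) (λ m _ → *-congˡ (w≈w′ m))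

  γ : ℕ → Carrier
  γ m = poch u m * v ^ m

  γ-recurrence : ∀ m → v * γ m ≈ γ (suc m) + (q ^ m * (u * v)) * γ m
  γ-recurrence m = solve 5 (λ P Q V u v → v :* (P :* V) := (P :* (con (+ 1) :- u :* Q)) :* (v :* V) :+ (Q :* (u :* v)) :* (P :* V))
                         refl (poch u m) (q ^ m) (v ^ m) u v

  pair-γ-zero : pair γ 0 ≈ 1#
  pair-γ-zero = trans (+-identityˡ _) (trans (*-cong (coeff-diag 0) (*-identityˡ _)) (*-identityˡ _))

  -- L annihilates Q_{j+1}: the recurrence for X Q_j, read in the functional with x := uv.
  pair-γ-suc : ∀ j → pair γ (suc j) ≈ 0#
  β-pair-γ : ∀ j → β (u * v) j * pair γ j ≈ 0#

  pair-γ-suc j = begin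
    pair γ (suc j)
      ≈⟨ solve 4 (λ P b s Z → P := (P :+ b :* Z :+ s) :- b :* Z :- s) refl _ _ _ _ ⟩
    (pair γ (suc j) + b (u * v) j * pair γ j + shiftʳ (λ i → β (u * v) i * pair γ i) j)
      - b (u * v) j * pair γ j - shiftʳ (λ i → β (u * v) i * pair γ i) j
      ≈⟨ +-congʳ (+-congʳ (trans (sym (pair-recurrence (u * v) γ (λ m → v * γ m) γ-recurrence j)) v-pair)) ⟩
    v * pair γ j - b (u * v) j * pair γ j - shiftʳ (λ i → β (u * v) i * pair γ i) j
      ≈⟨ remaining j ⟩
    0# ∎
    where
    v-pair : pair (λ m → v * γ m) j ≈ v * pair γ j
    v-pair = trans (sumLt-cong (suc j) (λ m _ → solve 3 (λ c v g → c :* (v :* g) := v :* (c :* g)) refl _ _ _))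
                   (sym (*-distribˡ-sumLt v _ (suc j)))
    remaining : ∀ j → v * pair γ j - b (u * v) j * pair γ j - shiftʳ (λ i → β (u * v) i * pair γ i) j ≈ 0#
    remaining zero = begin
      v * pair γ 0 - b (u * v) 0 * pair γ 0 - 0#
        ≈⟨ solve 3 (λ Z u v → v :* Z :- (one :* (u :* v) :+ v :* (one :- u)) :* Z :- zer := zer) refl _ u v ⟩
      0# ∎
    remaining (suc j) = begin
      v * pair γ (suc j) - b (u * v) (suc j) * pair γ (suc j) - β (u * v) j * pair γ j
        ≈⟨ +-cong (+-cong (*-congˡ (pair-γ-suc j)) (-‿cong (*-congˡ (pair-γ-suc j)))) (-‿cong (β-pair-γ j)) ⟩
      v * 0# - b (u * v) (suc j) * 0# - 0#
        ≈⟨ solve 2 (λ v b → v :* zer :- b :* zer :- zer := zer) refl _ _ ⟩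
      0# ∎

  β-pair-γ zero    = trans (*-congʳ (*-congˡ (solve 2 (λ u v → (u :* v) :* one :- u :* v := zer) refl u v))) (trans (*-congʳ (zeroʳ _)) (zeroˡ _))
  β-pair-γ (suc j) = trans (*-congˡ (pair-γ-suc j)) (zeroʳ _)

-- The moments α̃_k, with F i m = L(X^i p_m) and G i j = L(X^i Q_j).
module Moments {c ℓ : Level} (R : CommutativeRing c ℓ) (q u v x : CommutativeRing.Carrier R) where
  open CommutativeRing R hiding (zero)
  open import Relation.Binary.Reasoning.Setoid setoid
  open IntegerSolver R using (solve; _:=_; _:+_; _:*_; :-_; _:-_; con)
  open Sums R
  open QBinomial R q
  open OrthogonalPolynomials R q u v

  α : ℕ → Carrier
  α = alphaTilde R q u v x

  -- e m k is the coefficient of X^k in p_m.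
  e : ℕ → ℕ → Carrier
  e zero    zero    = 1#
  e zero    (suc k) = 0#
  e (suc m) zero    = - (q ^ m * x) * e m zero
  e (suc m) (suc k) = e m k - (q ^ m * x) * e m (suc k)

  e-> : ∀ m k → m < k → e m k ≈ 0#
  e-> zero    (suc k) _         = refl
  e-> (suc m) (suc k) (s≤s m<k) = trans (+-cong (e-> m k m<k) (-‿cong (*-congˡ (e-> m (suc k) (ℕ.m<n⇒m<1+n m<k)))))
    (solve 1 (λ y → con (+ 0) :- y :* con (+ 0) := con (+ 0)) refl _)

  e-diag : ∀ m → e m m ≈ 1#
  e-diag zero    = refl
  e-diag (suc m) = trans (+-cong (e-diag m) (-‿cong (*-congˡ (e-> m (suc m) ℕ.≤-refl))))
    (solve 1 (λ y → con (+ 1) :- y :* con (+ 0) := con (+ 1)) refl _)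

  F : ℕ → ℕ → Carrier
  F i m = Σ< (λ k → e m k * α (i ℕ.+ k)) (suc m)

  F-extend : ∀ i m {n} → suc m ≤ n → Σ< (λ k → e m k * α (i ℕ.+ k)) n ≈ F i m
  F-extend i m 1+m≤n = sumLt-extend _ 1+m≤n (λ k m<k → trans (*-congʳ (e-> m k m<k)) (zeroˡ _))

  F-recurrence : ∀ i m → F (suc i) m ≈ F i (suc m) + (q ^ m * x) * F i m
  F-recurrence i m = sym (begin
    F i (suc m) + Y * F i m
      ≈⟨ +-congʳ (sumLt-shift _ (suc m)) ⟩
    (e (suc m) 0 * α (i ℕ.+ 0) + Σ< (λ k → e (suc m) (suc k) * α (i ℕ.+ suc k)) (suc m)) + Y * F i m
      ≈⟨ +-congʳ (+-congˡ (sumLt-cong (suc m) (λ k _ → *-congˡ (reflexive (≡.cong α (ℕ.+-suc i k)))))) ⟩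
    (- Y * e m 0 * α (i ℕ.+ 0) + Σ< (λ k → (e m k - Y * e m (suc k)) * α (suc i ℕ.+ k)) (suc m)) + Y * F i m
      ≈⟨ +-congʳ (+-congˡ split) ⟩
    (- Y * e m 0 * α (i ℕ.+ 0) + (F (suc i) m - Y * S)) + Y * F i m
      ≈⟨ +-congˡ (*-congˡ (trans (sym (F-extend i m (ℕ.n≤1+n _))) (sumLt-shift _ (suc m)))) ⟩
    (- Y * e m 0 * α (i ℕ.+ 0) + (F (suc i) m - Y * S)) + Y * (e m 0 * α (i ℕ.+ 0) + Σ< (λ k → e m (suc k) * α (i ℕ.+ suc k)) (suc m))
      ≈⟨ +-congˡ (*-congˡ (+-congˡ (sumLt-cong (suc m) (λ k _ → *-congˡ (reflexive (≡.cong α (ℕ.+-suc i k))))))) ⟩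
    (- Y * e m 0 * α (i ℕ.+ 0) + (F (suc i) m - Y * S)) + Y * (e m 0 * α (i ℕ.+ 0) + S)
      ≈⟨ solve 5 (λ Y e A F₁ S → (:- Y :* e :* A :+ (F₁ :- Y :* S)) :+ Y :* (e :* A :+ S) := F₁) refl _ _ _ _ _ ⟩
    F (suc i) m ∎)
    where
    Y = q ^ m * x
    S = Σ< (λ k → e m (suc k) * α (suc i ℕ.+ k)) (suc m)
    split : Σ< (λ k → (e m k - Y * e m (suc k)) * α (suc i ℕ.+ k)) (suc m) ≈ F (suc i) m - Y * S
    split = trans (sumLt-cong (suc m) (λ k _ → solve 4 (λ e₁ e₂ Y A → (e₁ :- Y :* e₂) :* A := e₁ :* A :- Y :* (e₂ :* A)) refl _ _ _ _))
                  (trans (sumLt-distrib-+ _ _ (suc m))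
                         (+-congˡ (trans (sym (-‿distrib-sumLt _ (suc m))) (-‿cong (sym (*-distribˡ-sumLt _ _ (suc m)))))))

  -- Closed form of L(X^i p_m), from X p_m = p_{m+1} + q^m x p_m.
  Φ : ℕ → ℕ → Carrier
  Φ i m = Σ< (λ r → ([ i choose r ] * (q ^ m * x) ^ (i ∸ r)) * γ (m ℕ.+ r)) (suc i)

  Φ-zero : ∀ i → Φ i 0 ≈ α i
  Φ-zero i = sumLt-cong (suc i) (λ r _ → trans (*-congʳ (*-congˡ (pow-congˡ (i ∸ r) (*-identityˡ x))))
    (solve 4 (λ B X P V → (B :* X) :* (P :* V) := ((B :* P) :* V) :* X) refl _ _ _ _))

  Φ-recurrence : ∀ i m → Φ (suc i) m ≈ Φ i (suc m) + (q ^ m * x) * Φ i m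
  Φ-recurrence i m = begin
    Φ (suc i) m
      ≈⟨ sumLt-shift _ (suc i) ⟩
    (1# * Y ^ suc i) * γ (m ℕ.+ 0) + Σ< (λ r → ([ suc i choose suc r ] * Y ^ (i ∸ r)) * γ (m ℕ.+ suc r)) (suc i)
      ≈⟨ +-congˡ (sumLt-cong (suc i) (λ r r<1+i → trans (*-congʳ (*-congʳ (qBinom-pascal′ i r (ℕ.≤-pred r<1+i))))
           (solve 5 (λ Q B₁ B₂ X C → ((Q :* B₁ :+ B₂) :* X) :* C := (Q :* B₁ :* X) :* C :+ (B₂ :* X) :* C) refl _ _ _ _ _))) ⟩
    (1# * Y ^ suc i) * γ (m ℕ.+ 0) + Σ< (λ r → (q ^ (i ∸ r) * [ i choose r ] * Y ^ (i ∸ r)) * γ (m ℕ.+ suc r) + g r) (suc i)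
      ≈⟨ +-congˡ (trans (sumLt-distrib-+ _ _ (suc i)) (+-congʳ (sumLt-cong (suc i) (λ r _ → shifted r)))) ⟩
    (1# * Y ^ suc i) * γ (m ℕ.+ 0) + (Φ i (suc m) + Σ< g (suc i))
      ≈⟨ solve 3 (λ A P S → A :+ (P :+ S) := P :+ (A :+ S)) refl _ _ _ ⟩
    Φ i (suc m) + ((1# * Y ^ suc i) * γ (m ℕ.+ 0) + Σ< g (suc i))
      ≈⟨ +-congˡ (sym Y*Φ) ⟩
    Φ i (suc m) + Y * Φ i m ∎
    where
    Y = q ^ m * x
    g : ℕ → Carrier
    g r = ([ i choose suc r ] * Y ^ (i ∸ r)) * γ (m ℕ.+ suc r)
    shifted : ∀ r → (q ^ (i ∸ r) * [ i choose r ] * Y ^ (i ∸ r)) * γ (m ℕ.+ suc r)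
                    ≈ ([ i choose r ] * (q ^ suc m * x) ^ (i ∸ r)) * γ (suc m ℕ.+ r)
    shifted r = begin
      (q ^ (i ∸ r) * [ i choose r ] * Y ^ (i ∸ r)) * γ (m ℕ.+ suc r)
        ≈⟨ *-cong (solve 3 (λ Q B X → Q :* B :* X := B :* (Q :* X)) refl _ _ _) (reflexive (≡.cong γ (ℕ.+-suc m r))) ⟩
      ([ i choose r ] * (q ^ (i ∸ r) * Y ^ (i ∸ r))) * γ (suc m ℕ.+ r)
        ≈⟨ *-congʳ (*-congˡ (sym (trans (pow-congˡ (i ∸ r) (*-assoc q (q ^ m) x)) (pow-distrib-* q Y (i ∸ r))))) ⟩
      ([ i choose r ] * (q ^ suc m * x) ^ (i ∸ r)) * γ (suc m ℕ.+ r) ∎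
    Y*Φ : Y * Φ i m ≈ (1# * Y ^ suc i) * γ (m ℕ.+ 0) + Σ< g (suc i)
    Y*Φ = begin
      Y * Φ i m
        ≈⟨ *-congˡ (sumLt-shift _ i) ⟩
      Y * (([ i choose 0 ] * Y ^ i) * γ (m ℕ.+ 0) + Σ< (λ r → ([ i choose suc r ] * Y ^ (i ∸ suc r)) * γ (m ℕ.+ suc r)) i)
        ≈⟨ trans (distribˡ _ _ _) (+-cong (trans (absorb _ _ _) (*-congʳ (*-congʳ (qBinom-zero i)))) (*-distribˡ-sumLt _ _ i)) ⟩
      (1# * Y ^ suc i) * γ (m ℕ.+ 0) + Σ< (λ r → Y * (([ i choose suc r ] * Y ^ (i ∸ suc r)) * γ (m ℕ.+ suc r))) i
        ≈⟨ +-congˡ (sumLt-cong i (λ r r<i → trans (absorb _ _ _) (*-congʳ (*-congˡ (reflexive (≡.cong (Y ^_) (≡.sym (ℕ.+-∸-assoc 1 r<i)))))))) ⟩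
      (1# * Y ^ suc i) * γ (m ℕ.+ 0) + Σ< g i
        ≈⟨ +-congˡ (sym (trans (+-congˡ last≈0) (+-identityʳ _))) ⟩
      (1# * Y ^ suc i) * γ (m ℕ.+ 0) + Σ< g (suc i) ∎
      where
      absorb : ∀ B X C → Y * ((B * X) * C) ≈ (B * (Y * X)) * C
      absorb B X C = solve 4 (λ Y B X C → Y :* ((B :* X) :* C) := (B :* (Y :* X)) :* C) refl Y B X C
      last≈0 : g i ≈ 0#
      last≈0 = trans (*-congʳ (*-congʳ (qBinom-> i (suc i) ℕ.≤-refl))) (trans (*-congʳ (zeroˡ _)) (zeroˡ _))

  F≈Φ : ∀ m i → F i m ≈ Φ i m
  F≈Φ zero i = trans (+-identityˡ _) (trans (*-identityˡ _) (trans (reflexive (≡.cong α (ℕ.+-identityʳ i))) (sym (Φ-zero i))))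
  F≈Φ (suc m) i = begin
    F i (suc m)                          ≈⟨ solve 3 (λ A B C → A := (A :+ B :* C) :- B :* C) refl _ _ _ ⟩
    (F i (suc m) + Y * F i m) - Y * F i m ≈⟨ +-cong (sym (F-recurrence i m)) (-‿cong (*-congˡ (F≈Φ m i))) ⟩
    F (suc i) m - Y * Φ i m              ≈⟨ +-congʳ (trans (F≈Φ m (suc i)) (Φ-recurrence i m)) ⟩
    (Φ i (suc m) + Y * Φ i m) - Y * Φ i m ≈⟨ solve 2 (λ A B → (A :+ B) :- B := A) refl _ _ ⟩
    Φ i (suc m)                          ∎
    where Y = q ^ m * x

  F-zero : ∀ m → F 0 m ≈ γ m
  F-zero m = trans (F≈Φ m 0) (trans (+-identityˡ _) (trans (*-congʳ (*-identityʳ _))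
    (trans (*-identityˡ _) (reflexive (≡.cong γ (ℕ.+-identityʳ m))))))

  G : ℕ → ℕ → Carrier
  G i j = pair (F i) j

  G-recurrence : ∀ i j → G (suc i) j ≈ G i (suc j) + b x j * G i j + shiftʳ (λ l → β x l * G i l) j
  G-recurrence i = pair-recurrence x (F i) (F (suc i)) (F-recurrence i)

  G-upper : ∀ i j → i < j → G i j ≈ 0#
  G-upper zero (suc j) _ = trans (pair-cong (suc j) F-zero) (pair-γ-suc j)
  G-upper (suc i) j 1+i<j = begin
    G (suc i) j
      ≈⟨ G-recurrence i j ⟩
    G i (suc j) + b x j * G i j + shiftʳ (λ l → β x l * G i l) j
      ≈⟨ +-cong (+-cong (G-upper i (suc j) (ℕ.<-trans i<j (ℕ.n<1+n j))) (*-congˡ (G-upper i j i<j))) (lower j 1+i<j) ⟩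
    0# + b x j * 0# + 0#
      ≈⟨ solve 1 (λ y → con (+ 0) :+ y :* con (+ 0) :+ con (+ 0) := con (+ 0)) refl _ ⟩
    0# ∎
    where
    i<j = ℕ.<-trans (ℕ.n<1+n i) 1+i<j
    lower : ∀ j → suc i < j → shiftʳ (λ l → β x l * G i l) j ≈ 0#
    lower (suc j) (s≤s i<j) = trans (*-congˡ (G-upper i j i<j)) (zeroʳ _)

  G-diag : ∀ j → G j j ≈ Π< (β x) j
  G-diag zero    = trans (pair-cong 0 F-zero) pair-γ-zero
  G-diag (suc j) = begin
    G (suc j) (suc j)
      ≈⟨ G-recurrence j (suc j) ⟩
    G j (suc (suc j)) + b x (suc j) * G j (suc j) + β x j * G j j
      ≈⟨ +-cong (+-cong (G-upper j (suc (suc j)) (ℕ.<-trans (ℕ.n<1+n j) (ℕ.n<1+n _))) (*-congˡ (G-upper j (suc j) (ℕ.n<1+n j))))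
                (*-congˡ (G-diag j)) ⟩
    0# + b x (suc j) * 0# + β x j * Π< (β x) j
      ≈⟨ solve 2 (λ y B → con (+ 0) :+ y :* con (+ 0) :+ B := B) refl _ _ ⟩
    β x j * Π< (β x) j
      ≈⟨ *-comm _ _ ⟩
    Π< (β x) (suc j) ∎

  -- U k j is the coefficient of X^k in Q_j, so that (H U) i j = L(X^i Q_j) = G i j.
  U : ℕ → ℕ → Carrier
  U k j = Σ< (λ m → coeff j m * e m k) (suc j)

  U-diag : ∀ j → U j j ≈ 1#
  U-diag j = trans (sumLt-single _ (suc j) j ℕ.≤-refl others) (trans (*-cong (coeff-diag j) (e-diag j)) (*-identityˡ _))
    where
    others : ∀ m → m < suc j → m ≢ j → coeff j m * e m j ≈ 0#
    others m m<1+j m≢j = trans (*-congˡ (e-> m j (ℕ.≤∧≢⇒< (ℕ.≤-pred m<1+j) m≢j))) (zeroʳ _)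

  hankel-*-U : ∀ i j → Σ< (λ k → α (i ℕ.+ k) * U k j) (suc j) ≈ G i j
  hankel-*-U i j = begin
    Σ< (λ k → α (i ℕ.+ k) * U k j) (suc j)
      ≈⟨ sumLt-cong (suc j) (λ k _ → trans (*-comm _ _) (trans (*-distribʳ-sumLt _ _ (suc j))
           (sumLt-cong (suc j) (λ m _ → *-assoc _ _ _)))) ⟩
    Σ< (λ k → Σ< (λ m → coeff j m * (e m k * α (i ℕ.+ k))) (suc j)) (suc j)
      ≈⟨ sumLt-comm (λ k m → coeff j m * (e m k * α (i ℕ.+ k))) (suc j) (suc j) ⟩
    Σ< (λ m → Σ< (λ k → coeff j m * (e m k * α (i ℕ.+ k))) (suc j)) (suc j)
      ≈⟨ sumLt-cong (suc j) (λ m m<1+j → trans (sym (*-distribˡ-sumLt _ _ (suc j))) (*-congˡ (F-extend i m m<1+j))) ⟩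
    G i j ∎

module ProductFormula {c ℓ : Level} (R : CommutativeRing c ℓ) (q u v x : CommutativeRing.Carrier R) where
  open import Data.Nat.Combinatorics using (nCk+nC[k+1]≡[n+1]C[k+1]; nC1≡n)
  open CommutativeRing R hiding (zero)
  open import Relation.Binary.Reasoning.Setoid setoid
  open IntegerSolver R using (solve; _:=_; _:*_; _:-_; con)
  open Sums R
  open OrthogonalPolynomials R q u v using (β; κ; poch)

  A : ℕ → Carrier
  A i = (u * v) * q ^ i - x

  factor : ℕ → ℕ → Carrier
  factor n i = A i ^ (n ∸ i) * (poch u (n ∸ i) * poch q (n ∸ i))

  closedForm : ℕ → Carrier
  closedForm n = (v ^ (suc n C 2) * q ^ (suc n C 3)) * Π< (factor n) n

  prodLt-pow : ∀ n → Π< (q ^_) n ≈ q ^ (n C 2)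
  prodLt-pow zero    = refl
  prodLt-pow (suc n) = begin
    Π< (q ^_) n * q ^ n        ≈⟨ *-congʳ (prodLt-pow n) ⟩
    q ^ (n C 2) * q ^ n        ≈⟨ *-comm _ _ ⟩
    q ^ n * q ^ (n C 2)        ≈⟨ pow-homo-* q n (n C 2) ⟨
    q ^ (n ℕ.+ n C 2)          ≡⟨ ≡.cong (λ k → q ^ (k ℕ.+ n C 2)) (nC1≡n n) ⟨
    q ^ (n C 1 ℕ.+ n C 2)      ≡⟨ ≡.cong (q ^_) (nCk+nC[k+1]≡[n+1]C[k+1] n 1) ⟩
    q ^ (suc n C 2)            ∎

  prodLt-β : ∀ N → Π< (β x) N ≈ (((v ^ N * q ^ (N C 2)) * poch u N) * poch q N) * Π< A N
  prodLt-β N = begin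
    Π< (β x) N
      ≈⟨ prodLt-distrib-* _ _ N ⟩
    Π< (λ l → κ (q ^ l)) N * Π< A N
      ≈⟨ *-congʳ (trans (prodLt-distrib-* _ _ N) (*-congʳ (prodLt-distrib-* _ _ N))) ⟩
    ((Π< (λ l → v * q ^ l) N * poch u N) * poch q N) * Π< A N
      ≈⟨ *-congʳ (*-congʳ (*-congʳ (trans (prodLt-distrib-* _ _ N) (*-cong (prodLt-const v N) (prodLt-pow N))))) ⟩
    (((v ^ N * q ^ (N C 2)) * poch u N) * poch q N) * Π< A N ∎

  factor-suc : ∀ n i → i < suc n →
    factor (suc n) i ≈ factor n i * (A i * ((1# - u * q ^ (n ∸ i)) * (1# - q * q ^ (n ∸ i))))
  factor-suc n i i<1+n rewrite ℕ.+-∸-assoc 1 (ℕ.≤-pred i<1+n) =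
    solve 7 (λ Aᵢ X P₁ P₂ U Q e → (Aᵢ :* X) :* ((P₁ :* (con (+ 1) :- U :* e)) :* (P₂ :* (con (+ 1) :- Q :* e)))
                  := (X :* (P₁ :* P₂)) :* (Aᵢ :* ((con (+ 1) :- U :* e) :* (con (+ 1) :- Q :* e)))) refl _ _ _ _ _ _ _

  factor-diag : ∀ n → factor n n ≈ 1#
  factor-diag n rewrite ℕ.n∸n≡0 n = trans (*-identityˡ _) (*-identityˡ _)

  closedForm-suc : ∀ n → closedForm (suc n) ≈ closedForm n * Π< (β x) (suc n)
  closedForm-suc n = begin
    (v ^ (suc (suc n) C 2) * q ^ (suc (suc n) C 3)) * Π< (factor (suc n)) (suc n)
      ≈⟨ *-cong (*-cong (reflexive (≡.cong (v ^_) (≡.sym pascal₂))) (reflexive (≡.cong (q ^_) (≡.sym (nCk+nC[k+1]≡[n+1]C[k+1] (suc n) 2)))))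
                (prodLt-cong (suc n) (factor-suc n)) ⟩
    (v ^ (suc n ℕ.+ suc n C 2) * q ^ (suc n C 2 ℕ.+ suc n C 3)) * Π< (λ i → factor n i * g i) (suc n)
      ≈⟨ *-cong (*-cong (pow-homo-* v (suc n) (suc n C 2)) (pow-homo-* q (suc n C 2) (suc n C 3)))
                (trans (prodLt-distrib-* _ _ (suc n)) (*-cong (trans (*-congˡ (factor-diag n)) (*-identityʳ _)) prodLt-g)) ⟩
    ((v ^ suc n * v ^ (suc n C 2)) * (q ^ (suc n C 2) * q ^ (suc n C 3))) * (Π< (factor n) n * (Π< A (suc n) * (poch u (suc n) * poch q (suc n))))
      ≈⟨ solve 8 (λ V₁ V₂ Q₂ Q₃ Fn PA Pu Pq → ((V₁ :* V₂) :* (Q₂ :* Q₃)) :* (Fn :* (PA :* (Pu :* Pq)))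
                    := ((V₂ :* Q₃) :* Fn) :* ((((V₁ :* Q₂) :* Pu) :* Pq) :* PA)) refl _ _ _ _ _ _ _ _ ⟩
    closedForm n * ((((v ^ suc n * q ^ (suc n C 2)) * poch u (suc n)) * poch q (suc n)) * Π< A (suc n))
      ≈⟨ *-congˡ (prodLt-β (suc n)) ⟨
    closedForm n * Π< (β x) (suc n) ∎
    where
    g : ℕ → Carrier
    g i = A i * ((1# - u * q ^ (n ∸ i)) * (1# - q * q ^ (n ∸ i)))
    pascal₂ : suc n ℕ.+ suc n C 2 ≡ suc (suc n) C 2
    pascal₂ = ≡.trans (≡.cong (ℕ._+ suc n C 2) (≡.sym (nC1≡n (suc n)))) (nCk+nC[k+1]≡[n+1]C[k+1] (suc n) 1)
    prodLt-g : Π< g (suc n) ≈ Π< A (suc n) * (poch u (suc n) * poch q (suc n))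
    prodLt-g = trans (prodLt-distrib-* _ _ (suc n)) (*-congˡ (trans (prodLt-distrib-* _ _ (suc n))
      (*-cong (prodLt-reverse (λ k → 1# - u * q ^ k) n) (prodLt-reverse (λ k → 1# - q * q ^ k) n))))

  prodLt-prodLt-β : ∀ n → Π< (Π< (β x)) (suc n) ≈ closedForm n
  prodLt-prodLt-β zero    = solve 0 (con (+ 1) :* con (+ 1) := (con (+ 1) :* con (+ 1)) :* con (+ 1)) refl
  prodLt-prodLt-β (suc n) = trans (*-congʳ (prodLt-prodLt-β n)) (sym (closedForm-suc n))

theorem4p3 : {c ℓ : Level} (R : CommutativeRing c ℓ) →
  let open CommutativeRing R in
  (q u v x : Carrier) (n : ℕ) →
  hankel R (alphaTilde R q u v x) n ≈
    (pow R v (suc n C 2) * pow R q (suc n C 3)) *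
    prodLt R (λ i → pow R (_−_ R ((u * v) * pow R q i) x) (n ∸ i)
                    * (qPoch R u q (n ∸ i) * qPoch R q q (n ∸ i))) n
theorem4p3 R q u v x n = begin
  det R (suc n) (λ i j → H (toℕ i) (toℕ j))        ≈⟨ det≈det′ (suc n) H ⟩
  det′ (suc n) H                                    ≈⟨ det′-*-unitUpperTriangular (suc n) H U U-diag ⟨
  det′ (suc n) (λ i j → Σ< (λ k → H i k * U k j) (suc j)) ≈⟨ det′-cong (suc n) (λ i j _ → hankel-*-U i j) ⟩
  det′ (suc n) G                                    ≈⟨ det′-lowerTriangular (suc n) G G-upper ⟩
  Π< (λ i → G i i) (suc n)                          ≈⟨ prodLt-cong (suc n) (λ i _ → G-diag i) ⟩
  Π< (Π< (β x)) (suc n)                             ≈⟨ prodLt-prodLt-β n ⟩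
  closedForm n                                      ∎
  where
  open CommutativeRing R
  open import Relation.Binary.Reasoning.Setoid setoid
  open Sums R
  open Determinant R
  open OrthogonalPolynomials R q u v using (β)
  open Moments R q u v x
  open ProductFormula R q u v x using (prodLt-prodLt-β; closedForm)
  H : Matrix
  H i k = α (i ℕ.+ k)
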